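{- Let $q\ge5$ be a prime power and let $\mathcal{B}'$ be a minimal blocking set in $\mathrm{AG}(2,q)$ built with a $k$-construction, where $2q\le k\le 3q-5$. Then $\mathcal{B}'$ has the $\Pi$-property with respect to some direction $\Pi_\ell$.
   Context: A blocking set of $\mathrm{PG}(2,q)$ is a set of points meeting every line and containing no line; minimal if no proper subset is a blocking set. A line is tangent to a point set $\mathcal{K}$ if it meets it in exactly one point, secant if in more than one. $\mathcal{B}$ has the $r_\infty$-property with respect to $P\in\mathcal{B}$ if exactly one line through $P$ is tangent to $\mathcal{B}$ and all other lines through $P$ are secants. Projective $k$-construction ($q\ge4$): let $a,b,c$ be non-concurrent lines, $C=a\cap b$, $B=a\cap c$, $A=b\cap c$, $\mathcal{T}$ the vertexless triangle (points on exactly one of $a,b,c$). Choose a line $\ell_0$ through $A$ different from $b,c$, put $A'=\ell_0\cap a$, choose $D_1\in\ell_0\setminus\{A,A'\}$, put $B_1=BD_1\cap b$. If $q$ is odd, let $D_2=CC_2\cap\ell_0$ where $C_2=A'B_1\cap c$; if $q$ is even, choose $D_2\in\ell_0\setminus\{A,A',D_1\}$. Choose further distinct $D_3,\dots,D_n\in\ell_0\setminus\{A,A'\}$ different from $D_1,D_2$, with $2\le n\le q-2$; let $B_i=BD_i\cap b$, $C_i=CD_i\cap c$. The set $(\mathcal{T}\cup\{D_1,\dots,D_n\})\setminus\{B_1,\dots,B_n,C_1,\dots,C_n\}$ is a minimal blocking set of $\mathrm{PG}(2,q)$ of size $k=3q-3-n$, said to be built with a $k$-construction. Affine $k$-construction: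 a minimal blocking set $\mathcal{B}'$ of an affine plane $\mathrm{AG}(2,q)=\mathrm{PG}(2,q)\setminus r$ is built with a $k$-construction ($2q\le k\le 3q-5$) if $\mathcal{B}'=\mathcal{B}\setminus\{P\}$ where $\mathcal{B}$ is a minimal blocking set of $\mathrm{PG}(2,q)$ built with a $k$-construction, $P\in\mathcal{B}$ is a point with respect to which $\mathcal{B}$ has the $r_\infty$-property, and $r$ is the unique tangent to $\mathcal{B}$ through $P$. Here $\mathrm{PG}(2,q)\setminus r$ has as points those not on $r$ and as lines those other than $r$. A blocking set of the affine plane meets every affine line; a direction (parallel class) $\Pi_\ell$ is the set of affine lines parallel to a given affine line $\ell$. An affine blocking set $\mathcal{B}'$ has the $\Pi$-property with respect to a direction $\Pi$ if: (j) through every $Q\in\mathcal{B}'$ there is an affine line $m\notin\Pi$ tangent to $\mathcal{B}'$; (jj) no line of $\Pi$ is contained in $\mathcal{B}'$. -}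

module Defs where

open import Level using (0ℓ)
open import Data.Nat using (ℕ; zero; suc; _≤_; _∸_; _%_)
open import Data.Nat.Properties using ()
open import Data.Fin using (Fin)
open import Data.Product using (Σ; ∃; ∃-syntax; _×_; _,_)
open import Data.Sum using (_⊎_)
open import Relation.Nullary using (¬_)
open import Relation.Binary.PropositionalEquality using (_≡_)
open import Function.Bundles using (_↔_; _⇔_)
open import Algebra.Core using (Op₁; Op₂)
open import Algebra.Structures using (IsCommutativeRing)

-- A finite field with exactly q elements (GF(q)); q is then
-- automatically a prime power.  Equality is propositional.

record FiniteField (q : ℕ) : Set₁ where
  infixl 7 _*_
  infixl 6 _+_
  field
    Carrier  : Set
    _+_ _*_  : Op₂ Carrier
    -_       : Op₁ Carrier
    0# 1#    : Carrier
    isCommutativeRing : IsCommutativeRing _≡_ _+_ _*_ -_ 0# 1#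
    0≢1      : ¬ (0# ≡ 1#)
    inverse  : ∀ x → ¬ (x ≡ 0#) → ∃[ y ] (x * y ≡ 1#)
    enum     : Carrier ↔ Fin q

-- Points and lines are nonzero vectors of F³, considered up to a
-- nonzero scalar factor (the relation _~_ below); incidence is the
-- vanishing of the standard bilinear form.

module Plane {q : ℕ} (F : FiniteField q) where
  open FiniteField F

  record Vec3 : Set where
    constructor ⟨_,_,_⟩
    field
      x₀ x₁ x₂ : Carrier
      nonzero  : ¬ ((x₀ ≡ 0#) × (x₁ ≡ 0#) × (x₂ ≡ 0#))
  open Vec3 public

  Point : Set
  Point = Vec3

  Line : Set
  Line = Vec3

  _~_ : Vec3 → Vec3 → Set
  u ~ v = ∃[ λ′ ] ((¬ (λ′ ≡ 0#)) ×
            ((x₀ u ≡ λ′ * x₀ v) × (x₁ u ≡ λ′ * x₁ v) × (x₂ u ≡ λ′ * x₂ v)))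

  _∈ₗ_ : Point → Line → Set
  P ∈ₗ ℓ = (x₀ ℓ * x₀ P) + (x₁ ℓ * x₁ P) + (x₂ ℓ * x₂ P) ≡ 0#

  Collinear : Point → Point → Point → Set
  Collinear P Q R = ∃[ ℓ ] ((P ∈ₗ ℓ) × (Q ∈ₗ ℓ) × (R ∈ₗ ℓ))

  PointSet : Set₁
  PointSet = Point → Set

  Tangent : PointSet → Line → Set
  Tangent 𝒦 ℓ = ∃[ X ] ((X ∈ₗ ℓ) × 𝒦 X × (∀ Y → Y ∈ₗ ℓ → 𝒦 Y → Y ~ X))

  Secant : PointSet → Line → Set
  Secant 𝒦 ℓ = ∃[ X ] ∃[ Y ] ((X ∈ₗ ℓ) × (Y ∈ₗ ℓ) × 𝒦 X × 𝒦 Y × ¬ (X ~ Y))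

  r∞-Property : PointSet → Point → Line → Set
  r∞-Property ℬ P r =
    ℬ P × (P ∈ₗ r) × Tangent ℬ r
    × (∀ m → P ∈ₗ m → Tangent ℬ m → m ~ r)
    × (∀ m → P ∈ₗ m → ¬ (m ~ r) → Secant ℬ m)

  record KConstruction (n : ℕ) : Set where
    field
      a b c : Line
      nonConcurrent : ¬ (∃[ X ] ((X ∈ₗ a) × (X ∈ₗ b) × (X ∈ₗ c)))
      A B C : Point
      C∈a : C ∈ₗ a
      C∈b : C ∈ₗ b
      B∈a : B ∈ₗ a
      B∈c : B ∈ₗ c
      A∈b : A ∈ₗ b
      A∈c : A ∈ₗ c
      ℓ₀ : Line
      A∈ℓ₀ : A ∈ₗ ℓ₀
      ℓ₀≁b : ¬ (ℓ₀ ~ b)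
      ℓ₀≁c : ¬ (ℓ₀ ~ c)
      A′ : Point
      A′∈ℓ₀ : A′ ∈ₗ ℓ₀
      A′∈a : A′ ∈ₗ a
      -- D i = D_{i+1}
      D : Fin n → Point
      D∈ℓ₀ : ∀ i → D i ∈ₗ ℓ₀
      D≁A  : ∀ i → ¬ (D i ~ A)
      D≁A′ : ∀ i → ¬ (D i ~ A′)
      D-distinct : ∀ i j → D i ~ D j → i ≡ j

  module _ {n : ℕ} (K : KConstruction n) where
    open KConstruction K

    𝒯 : PointSet
    𝒯 X = ((X ∈ₗ a) × ¬ (X ∈ₗ b) × ¬ (X ∈ₗ c))
        ⊎ ((¬ (X ∈ₗ a)) × (X ∈ₗ b) × ¬ (X ∈ₗ c))
        ⊎ ((¬ (X ∈ₗ a)) × ¬ (X ∈ₗ b) × (X ∈ₗ c))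

    IsBᵢ : Fin n → Point → Set
    IsBᵢ i X = (X ∈ₗ b) × Collinear B (D i) X

    IsCᵢ : Fin n → Point → Set
    IsCᵢ i X = (X ∈ₗ c) × Collinear C (D i) X

    constructedSet : PointSet
    constructedSet X =
      (𝒯 X ⊎ (∃[ i ] (X ~ D i)))
      × ¬ (∃[ i ] IsBᵢ i X)
      × ¬ (∃[ i ] IsCᵢ i X)

  -- Condition on D₂ in odd characteristic: D₂ = CC₂ ∩ ℓ₀ with
  -- C₂ = A′B₁ ∩ c and B₁ = BD₁ ∩ b.
  OddCondition : {n : ℕ} → KConstruction (suc (suc n)) → Set
  OddCondition K =
    ∀ B₁ C₂ → IsBᵢ K Fin.zero B₁ → (C₂ ∈ₗ c) → Collinear A′ B₁ C₂ →
      Collinear C C₂ (D (Fin.suc Fin.zero))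
    where open KConstruction K

  BuiltWithKConstruction : ℕ → PointSet → Set
  BuiltWithKConstruction k ℬ =
    ∃[ n ] Σ (KConstruction (suc (suc n))) λ K →
      (suc (suc n) ≤ q ∸ 2)
      × (k ≡ (3 Data.Nat.* q) ∸ 3 ∸ suc (suc n))
      × (q % 2 ≡ 1 → OddCondition K)
      × (∀ X → ℬ X ⇔ constructedSet K X)

  -- The affine plane AG(2,q) = PG(2,q) ∖ r.

  module Affine (r : Line) where

    AffPoint : Point → Set
    AffPoint X = ¬ (X ∈ₗ r)

    AffLine : Line → Set
    AffLine m = ¬ (m ~ r)

    IsAffSet : PointSet → Set
    IsAffSet 𝒦 = ∀ X → 𝒦 X → AffPoint X

    Respects~ : PointSet → Set
    Respects~ 𝒦 = ∀ X Y → X ~ Y → 𝒦 X → 𝒦 Y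

    AffBlocking : PointSet → Set
    AffBlocking 𝒦 = IsAffSet 𝒦 × (∀ m → AffLine m → ∃[ X ] ((X ∈ₗ m) × 𝒦 X))

    MinimalAffBlocking : PointSet → Set₁
    MinimalAffBlocking 𝒦 =
      AffBlocking 𝒦 ×
      (∀ (𝒦′ : PointSet) → Respects~ 𝒦′ → (∀ X → 𝒦′ X → 𝒦 X) →
         AffBlocking 𝒦′ → ∀ X → 𝒦 X → 𝒦′ X)

    AffTangent : PointSet → Line → Set
    AffTangent 𝒦 m = ∃[ X ] (AffPoint X × (X ∈ₗ m) × 𝒦 X ×
                       (∀ Y → AffPoint Y → Y ∈ₗ m → 𝒦 Y → Y ~ X))

    -- m ∈ Π_ℓ : m is parallel to ℓ (equal, or no common affine point)
    Parallel : Line → Line → Set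
    Parallel ℓ m = (m ~ ℓ) ⊎ ¬ (∃[ X ] (AffPoint X × (X ∈ₗ ℓ) × (X ∈ₗ m)))

    ΠProperty : PointSet → Line → Set
    ΠProperty 𝒦 ℓ =
      (∀ Q → 𝒦 Q → ∃[ m ] (AffLine m × (Q ∈ₗ m) × ¬ Parallel ℓ m × AffTangent 𝒦 m))
      × (∀ m → AffLine m → Parallel ℓ m →
           ¬ (∀ X → AffPoint X → X ∈ₗ m → 𝒦 X))

  AffBuiltWithKConstruction : ℕ → Line → PointSet → Set₁
  AffBuiltWithKConstruction k r ℬ′ =
    Σ PointSet λ ℬ → Σ Point λ P →
      BuiltWithKConstruction k ℬ
      × r∞-Property ℬ P r
      × (∀ X → ℬ′ X ⇔ (ℬ X × ¬ (X ~ P)))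

{-# OPTIONS --safe #-}
-- Take for Π_ℓ the direction of any line ℓ ≠ r through P; its affine lines are exactly the
-- affine lines through P. Every point Q of the projective blocking set ℬ = ℬ′ ∪ {P} lies on a
-- line meeting ℬ only in Q: QA, QB or QC when Q is on a, b or c, D_iB when Q = D_i, and A′B₁
-- when Q = A′. The last one works because A′B₁ meets c in a deleted point: in C₂ by the choice
-- of D₂ when q is odd, and in C₁ by Fano's theorem when q is even. These tangents miss P, so
-- none of them is in Π_ℓ, which gives (j). For (jj), an affine line m through P contains an
-- affine point outside ℬ: a vertex of the triangle, or a point V + tP of m off three of the
-- lines a, b, c, ℓ₀, which exists because at most three of the q ≥ 4 values of t are excluded.
module Submission where

open import Defs
open import Level using (0ℓ)
open import Algebra.Bundles using (CommutativeRing; RawRing)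
open import Algebra.Solver.Ring.AlmostCommutativeRing using (_-Raw-AlmostCommutative⟶_; fromCommutativeRing)
open import Data.Fin as Fin using (Fin; zero; suc)
import Data.Fin.Properties as Fin
open import Data.Integer as ℤ using (ℤ; -[1+_]; _⊖_)
import Data.Integer.Properties as ℤ
open import Data.List using (List; []; _∷_; length; filter; tabulate)
open import Data.List.Properties using (filter-accept; filter-reject; filter-all; length-tabulate)
open import Data.List.Membership.Propositional.Properties using (∈-filter⁺; ∈-filter⁻; ∈-tabulate⁺)
open import Data.List.Relation.Unary.All as All using (All)
open import Data.List.Relation.Unary.AllPairs using (_∷_)
open import Data.List.Relation.Unary.Any using (here; there)
open import Data.List.Relation.Unary.Unique.Propositional using (Unique)
import Data.List.Relation.Unary.Unique.Propositional.Properties as Unique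
open import Data.Maybe using (Maybe; just; nothing)
open import Data.Nat as ℕ using (ℕ; zero; suc; _<_; _≤_; _%_)
import Data.Nat.Properties as ℕ
open import Data.Nat.Divisibility using (_∣_; divides; ∣-refl; ∣1⇒≡1; ∣m∣n⇒∣m+n; ∣m+n∣m⇒∣n)
open import Data.Product as Product using (∃-syntax; _×_; _,_; proj₁; proj₂)
open import Data.Sign as Sign using (Sign)
open import Data.Sum as Sum using (_⊎_; inj₁; inj₂)
open import Data.Vec.N-ary using (N-ary)
open import Function using (id; _∘_; _⇔_)
open import Function.Bundles using (Equivalence; Injection; Inverse)
open import Function.Properties.Inverse using (↔⇒↣; ↔-sym)
open import Relation.Binary.Definitions using (DecidableEquality)
open import Relation.Binary.PropositionalEquality
  using (_≡_; _≢_; refl; sym; trans; cong; cong₂; subst; module ≡-Reasoning)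
open import Relation.Nullary using (¬_; Dec; yes; no; contradiction)
open import Relation.Nullary.Decidable using (map′; via-injection; decidable-stable; ¬?; _×-dec_)

-- Algebra.Solver.Ring.Simple would take the field itself as coefficient ring, but its
-- equality test does not compute on open terms; integer coefficients do.
module IntegerCoefficients {c ℓ} (R : CommutativeRing c ℓ) where
  open CommutativeRing R renaming (refl to ≈-refl; sym to ≈-sym; trans to ≈-trans)
  open import Algebra.Properties.Ring ring
    using (-0#≈0#; -‿involutive; -‿+-comm; -‿distribˡ-*; -‿distribʳ-*)
  open import Algebra.Properties.Semiring.Mult semiring using (×-homo-+; ×1-homo-*) renaming (_×_ to _×ᵣ_)
  open import Relation.Binary.Reasoning.Setoid setoid

  fromℤ : ℤ → Carrier
  fromℤ (ℤ.+ n)      = n ×ᵣ 1#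
  fromℤ -[1+ n ]   = - (suc n ×ᵣ 1#)

  signed : Sign → Carrier → Carrier
  signed Sign.+ x = x
  signed Sign.- x = - x

  fromℤ-signed : ∀ i → fromℤ i ≈ signed (ℤ.sign i) (ℤ.∣ i ∣ ×ᵣ 1#)
  fromℤ-signed (ℤ.+ n)      = ≈-refl
  fromℤ-signed -[1+ n ]   = ≈-refl

  fromℤ-homo-◃ : ∀ s n → fromℤ (s ℤ.◃ n) ≈ signed s (n ×ᵣ 1#)
  fromℤ-homo-◃ Sign.- zero    = ≈-sym -0#≈0#
  fromℤ-homo-◃ Sign.+ zero    = ≈-refl
  fromℤ-homo-◃ Sign.- (suc n) = ≈-refl
  fromℤ-homo-◃ Sign.+ (suc n) = ≈-refl

  signed-* : ∀ s t x y → signed (s Sign.* t) (x * y) ≈ signed s x * signed t y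
  signed-* Sign.+ Sign.+ x y = ≈-refl
  signed-* Sign.+ Sign.- x y = -‿distribʳ-* x y
  signed-* Sign.- Sign.+ x y = -‿distribˡ-* x y
  signed-* Sign.- Sign.- x y = begin
    x * y         ≈⟨ -‿involutive _ ⟨
    - - (x * y)   ≈⟨ -‿cong (-‿distribʳ-* x y) ⟩
    - (x * - y)   ≈⟨ -‿distribˡ-* x (- y) ⟩
    - x * - y     ∎

  x+y-[x+z]≈y-z : ∀ x y z → (x + y) - (x + z) ≈ y - z
  x+y-[x+z]≈y-z x y z = begin
    (x + y) - (x + z)     ≈⟨ +-congˡ (-‿+-comm x z) ⟨
    (x + y) + (- x - z)   ≈⟨ +-congʳ (+-comm x y) ⟩
    (y + x) + (- x - z)   ≈⟨ +-assoc y x _ ⟩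
    y + (x + (- x - z))   ≈⟨ +-congˡ (+-assoc x (- x) (- z)) ⟨
    y + ((x - x) - z)     ≈⟨ +-congˡ (+-congʳ (-‿inverseʳ x)) ⟩
    y + (0# - z)          ≈⟨ +-congˡ (+-identityˡ (- z)) ⟩
    y - z                 ∎

  fromℤ-homo-⊖ : ∀ m n → fromℤ (m ⊖ n) ≈ m ×ᵣ 1# - n ×ᵣ 1#
  fromℤ-homo-⊖ zero    zero    = ≈-sym (≈-trans (+-congˡ -0#≈0#) (+-identityʳ 0#))
  fromℤ-homo-⊖ zero    (suc n) = ≈-sym (+-identityˡ _)
  fromℤ-homo-⊖ (suc m) zero    = ≈-sym (≈-trans (+-congˡ -0#≈0#) (+-identityʳ _))
  fromℤ-homo-⊖ (suc m) (suc n) = begin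
    fromℤ (suc m ⊖ suc n)             ≡⟨ cong fromℤ (ℤ.[1+m]⊖[1+n]≡m⊖n m n) ⟩
    fromℤ (m ⊖ n)                     ≈⟨ fromℤ-homo-⊖ m n ⟩
    m ×ᵣ 1# - n ×ᵣ 1#               ≈⟨ x+y-[x+z]≈y-z 1# _ _ ⟨
    suc m ×ᵣ 1# - suc n ×ᵣ 1#       ∎

  fromℤ-homo-+ : ∀ i j → fromℤ (i ℤ.+ j) ≈ fromℤ i + fromℤ j
  fromℤ-homo-+ (ℤ.+ m)      (ℤ.+ n)      = ×-homo-+ 1# m n
  fromℤ-homo-+ (ℤ.+ m)      -[1+ n ]   = fromℤ-homo-⊖ m (suc n)
  fromℤ-homo-+ -[1+ m ]   (ℤ.+ n)      = ≈-trans (fromℤ-homo-⊖ n (suc m)) (+-comm _ _)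
  fromℤ-homo-+ -[1+ m ]   -[1+ n ]   = begin
    - (suc (suc (m ℕ.+ n)) ×ᵣ 1#)      ≡⟨ cong (λ k → - (suc k ×ᵣ 1#)) (ℕ.+-suc m n) ⟨
    - ((suc m ℕ.+ suc n) ×ᵣ 1#)        ≈⟨ -‿cong (×-homo-+ 1# (suc m) (suc n)) ⟩
    - (suc m ×ᵣ 1# + suc n ×ᵣ 1#)       ≈⟨ -‿+-comm _ _ ⟨
    - (suc m ×ᵣ 1#) - (suc n ×ᵣ 1#)     ∎

  fromℤ-homo-* : ∀ i j → fromℤ (i ℤ.* j) ≈ fromℤ i * fromℤ j
  fromℤ-homo-* i j = begin
    fromℤ (s ℤ.◃ ℤ.∣ i ∣ ℕ.* ℤ.∣ j ∣)                   ≈⟨ fromℤ-homo-◃ s (ℤ.∣ i ∣ ℕ.* ℤ.∣ j ∣) ⟩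
    signed s ((ℤ.∣ i ∣ ℕ.* ℤ.∣ j ∣) ×ᵣ 1#)             ≈⟨ signed-cong s (×1-homo-* ℤ.∣ i ∣ ℤ.∣ j ∣) ⟩
    signed s ((ℤ.∣ i ∣ ×ᵣ 1#) * (ℤ.∣ j ∣ ×ᵣ 1#))        ≈⟨ signed-* (ℤ.sign i) (ℤ.sign j) _ _ ⟩
    signed (ℤ.sign i) (ℤ.∣ i ∣ ×ᵣ 1#) * signed (ℤ.sign j) (ℤ.∣ j ∣ ×ᵣ 1#) ≈⟨ *-cong (fromℤ-signed i) (fromℤ-signed j) ⟨
    fromℤ i * fromℤ j                                     ∎
    where
    s : Sign
    s = ℤ.sign i Sign.* ℤ.sign j
    signed-cong : ∀ s {x y} → x ≈ y → signed s x ≈ signed s y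
    signed-cong Sign.+ x≈y = x≈y
    signed-cong Sign.- x≈y = -‿cong x≈y

  fromℤ-homo-neg : ∀ i → fromℤ (ℤ.- i) ≈ - fromℤ i
  fromℤ-homo-neg (ℤ.+ zero)    = ≈-sym -0#≈0#
  fromℤ-homo-neg (ℤ.+ suc n)   = ≈-refl
  fromℤ-homo-neg -[1+ n ]    = ≈-sym (-‿involutive _)

  homomorphism : ℤ.+-*-rawRing -Raw-AlmostCommutative⟶ fromCommutativeRing R
  homomorphism = record
    { ⟦_⟧ = fromℤ ; +-homo = fromℤ-homo-+ ; *-homo = fromℤ-homo-* ; -‿homo = fromℤ-homo-neg
    ; 0-homo = ≈-refl ; 1-homo = +-identityʳ 1# }

  fromℤ-equal? : ∀ i j → Maybe (fromℤ i ≈ fromℤ j)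
  fromℤ-equal? i j with i ℤ.≟ j
  ... | yes i≡j = just (reflexive (cong fromℤ i≡j))
  ... | no  _   = nothing

  open import Algebra.Solver.Ring ℤ.+-*-rawRing (fromCommutativeRing R) homomorphism fromℤ-equal? public

module InvolutionParity {A : Set} (_≟_ : DecidableEquality A)
  (σ : A → A) (σ-involutive : ∀ x → σ (σ x) ≡ x) where
  open import Data.List.Membership.Propositional using (_∈_)

  _≢?_ : ∀ y v → Dec (y ≢ v)
  y ≢? v = ¬? (y ≟ v)

  without : A → List A → List A
  without v = filter (_≢? v)

  Closed : List A → Set
  Closed xs = ∀ {x} → x ∈ xs → σ x ∈ xs

  FixedPointFree : List A → Set
  FixedPointFree xs = ∀ {x} → x ∈ xs → σ x ≢ x

  σ-injective : ∀ {x y} → σ x ≡ σ y → x ≡ y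
  σ-injective {x} {y} σx≡σy = trans (sym (σ-involutive x)) (trans (cong σ σx≡σy) (σ-involutive y))

  length-without : ∀ {v xs} → Unique xs → v ∈ xs → suc (length (without v xs)) ≡ length xs
  length-without {xs = x ∷ xs} (x∉xs ∷ _) (here refl) = cong (suc ∘ length) (begin
    without x (x ∷ xs)  ≡⟨ filter-reject (_≢? x) (λ x≢x → x≢x refl) ⟩
    without x xs        ≡⟨ filter-all (_≢? x) (All.map (λ x≢y y≡x → x≢y (sym y≡x)) x∉xs) ⟩
    xs                  ∎)
    where open ≡-Reasoning
  length-without {v} {x ∷ xs} (x∉xs ∷ u) (there v∈xs) = begin
    suc (length (without v (x ∷ xs)))    ≡⟨ cong (suc ∘ length) (filter-accept (_≢? v) (All.lookup x∉xs v∈xs)) ⟩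
    suc (suc (length (without v xs)))    ≡⟨ cong suc (length-without u v∈xs) ⟩
    suc (length xs)                      ∎
    where open ≡-Reasoning

  -- Indexed by the length, so that removing both x and σ x is structural recursion on n.
  fixedPointFree⇒even : ∀ n xs → length xs ≡ n → Unique xs → Closed xs → FixedPointFree xs → 2 ∣ n
  fixedPointFree⇒even zero          []           _  _ _ _   = divides 0 refl
  fixedPointFree⇒even (suc zero)    (x ∷ [])     _  _ cl fpf with cl (here refl)
  ... | here σx≡x = contradiction σx≡x (fpf (here refl))
  fixedPointFree⇒even (suc (suc n)) (x ∷ ys) |xs| (x∉ys ∷ u) cl fpf
    = ∣m∣n⇒∣m+n ∣-refl
        (fixedPointFree⇒even n zs |zs| (Unique.filter⁺ (_≢? σ x) u) zs-closed (fpf ∘ there ∘ ⊆ys))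
    where
    σx∈ys : σ x ∈ ys
    σx∈ys with cl (here refl)
    ... | here σx≡x = contradiction σx≡x (fpf (here refl))
    ... | there σx∈ys = σx∈ys
    zs : List A
    zs = without (σ x) ys
    |zs| : length zs ≡ n
    |zs| = ℕ.suc-injective (ℕ.suc-injective (trans (cong suc (length-without u σx∈ys)) |xs|))
    ⊆ys : ∀ {y} → y ∈ zs → y ∈ ys
    ⊆ys y∈zs = proj₁ (∈-filter⁻ (_≢? σ x) y∈zs)
    zs-closed : Closed zs
    zs-closed {y} y∈zs with ∈-filter⁻ (_≢? σ x) y∈zs | cl (there (⊆ys y∈zs))
    ... | _ , y≢σx | here σy≡x = contradiction (σ-injective (trans σy≡x (sym (σ-involutive x)))) y≢σx
    ... | y∈ys , _ | there σy∈ys =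
      ∈-filter⁺ (_≢? σ x) σy∈ys (λ σy≡σx → All.lookup x∉ys y∈ys (sym (σ-injective σy≡σx)))

module TripleAlgebra {ℓ₁ ℓ₂} (R : RawRing ℓ₁ ℓ₂) where
  open RawRing R using (Carrier; _+_; _*_; -_)
  infixl 6 _⊕_
  infixr 7 _⊛_
  infixl 9 _⨯_
  infix 8 _∙_

  record Triple : Set ℓ₁ where
    constructor triple
    field t₀ t₁ t₂ : Carrier
  open Triple public

  coord : Fin 3 → Triple → Carrier
  coord zero             = t₀
  coord (suc zero)       = t₁
  coord (suc (suc zero)) = t₂

  _∙_ : Triple → Triple → Carrier
  u ∙ v = t₀ u * t₀ v + t₁ u * t₁ v + t₂ u * t₂ v

  _⨯_ : Triple → Triple → Triple
  u ⨯ v = triple (t₁ u * t₂ v + - (t₂ u * t₁ v))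
                 (t₂ u * t₀ v + - (t₀ u * t₂ v))
                 (t₀ u * t₁ v + - (t₁ u * t₀ v))

  _⊕_ : Triple → Triple → Triple
  u ⊕ v = triple (t₀ u + t₀ v) (t₁ u + t₁ v) (t₂ u + t₂ v)

  _⊛_ : Carrier → Triple → Triple
  s ⊛ v = triple (s * t₀ v) (s * t₁ v) (s * t₂ v)

  triple-cong : ∀ {a b c a′ b′ c′} → a ≡ a′ → b ≡ b′ → c ≡ c′ → triple a b c ≡ triple a′ b′ c′
  triple-cong refl refl refl = refl

  coord-ext : ∀ {u v} → (∀ i → coord i u ≡ coord i v) → u ≡ v
  coord-ext u≗v = triple-cong (u≗v zero) (u≗v (suc zero)) (u≗v (suc (suc zero)))

module FieldProperties {q} (F : FiniteField q) where
  open FiniteField F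

  commutativeRing : CommutativeRing 0ℓ 0ℓ
  commutativeRing = record { isCommutativeRing = isCommutativeRing }

  open CommutativeRing commutativeRing public
    using ( *-assoc; *-comm; +-identityˡ; +-identityʳ; *-identityˡ; *-identityʳ
          ; -‿inverseˡ; -‿inverseʳ; distribʳ; zeroˡ; zeroʳ; ring; _-_)
  open import Algebra.Properties.Ring ring public
    using (-‿involutive; -0#≈0#; -‿distribˡ-*; +-inverseˡ-unique; +-inverseʳ-unique; x∙y⁻¹≈ε⇒x≈y)
  open IntegerCoefficients commutativeRing public using (solve; _:=_; _:+_; _:*_; :-_; _:-_; con; Polynomial)

  polynomialRawRing : ℕ → RawRing 0ℓ 0ℓ
  polynomialRawRing n = record
    { Carrier = Polynomial n ; _≈_ = _≡_
    ; _+_ = _:+_ ; _*_ = _:*_ ; -_ = :-_ ; 0# = con (ℤ.+ 0) ; 1# = con (ℤ.+ 1) }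

  infix 4 _≟_
  _≟_ : DecidableEquality Carrier
  _≟_ = via-injection (↔⇒↣ enum) Fin._≟_

  1≢0 : 1# ≢ 0#
  1≢0 1≡0 = 0≢1 (sym 1≡0)

  inv : (x : Carrier) → x ≢ 0# → Carrier
  inv x x≢0 = proj₁ (inverse x x≢0)

  inv-inverseʳ : ∀ x (x≢0 : x ≢ 0#) → x * inv x x≢0 ≡ 1#
  inv-inverseʳ x x≢0 = proj₂ (inverse x x≢0)

  inv-inverseˡ : ∀ x (x≢0 : x ≢ 0#) → inv x x≢0 * x ≡ 1#
  inv-inverseˡ x x≢0 = trans (*-comm _ _) (inv-inverseʳ x x≢0)

  inv-nonzero : ∀ x (x≢0 : x ≢ 0#) → inv x x≢0 ≢ 0#
  inv-nonzero x x≢0 inv≡0 = 1≢0 (begin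
    1#              ≡⟨ inv-inverseʳ x x≢0 ⟨
    x * inv x x≢0   ≡⟨ cong (x *_) inv≡0 ⟩
    x * 0#          ≡⟨ zeroʳ x ⟩
    0#              ∎)
    where open ≡-Reasoning

  *-solveˡ : ∀ {x y} c (c≢0 : c ≢ 0#) → y ≡ c * x → x ≡ inv c c≢0 * y
  *-solveˡ {x} {y} c c≢0 y≡cx = begin
    x                      ≡⟨ *-identityˡ x ⟨
    1# * x                 ≡⟨ cong (_* x) (inv-inverseˡ c c≢0) ⟨
    (inv c c≢0 * c) * x    ≡⟨ *-assoc _ c x ⟩
    inv c c≢0 * (c * x)    ≡⟨ cong (inv c c≢0 *_) y≡cx ⟨
    inv c c≢0 * y          ∎
    where open ≡-Reasoning

  *-ratio : ∀ {x y z w} (z≢0 : z ≢ 0#) → y * z ≡ x * w → y ≡ (x * inv z z≢0) * w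
  *-ratio {x} {y} {z} {w} z≢0 yz≡xw = begin
    y                            ≡⟨ *-identityʳ y ⟨
    y * 1#                       ≡⟨ cong (y *_) (inv-inverseʳ z z≢0) ⟨
    y * (z * inv z z≢0)          ≡⟨ *-assoc y z _ ⟨
    (y * z) * inv z z≢0          ≡⟨ cong (_* inv z z≢0) yz≡xw ⟩
    (x * w) * inv z z≢0          ≡⟨ *-assoc x w _ ⟩
    x * (w * inv z z≢0)          ≡⟨ cong (x *_) (*-comm w _) ⟩
    x * (inv z z≢0 * w)          ≡⟨ *-assoc x _ w ⟨
    (x * inv z z≢0) * w          ∎
    where open ≡-Reasoning

  x*y≡0⇒y≡0 : ∀ {x y} → x ≢ 0# → x * y ≡ 0# → y ≡ 0#
  x*y≡0⇒y≡0 {x} {y} x≢0 xy≡0 = trans (*-solveˡ x x≢0 (sym xy≡0)) (zeroʳ _)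

  *-nonzero : ∀ {x y} → x ≢ 0# → y ≢ 0# → x * y ≢ 0#
  *-nonzero x≢0 y≢0 = y≢0 ∘ x*y≡0⇒y≡0 x≢0

  -x≡0⇒x≡0 : ∀ {x} → - x ≡ 0# → x ≡ 0#
  -x≡0⇒x≡0 {x} -x≡0 = trans (sym (-‿involutive x)) (trans (cong -_ -x≡0) -0#≈0#)

  [1+1]*x≡x+x : ∀ x → (1# + 1#) * x ≡ x + x
  [1+1]*x≡x+x x = trans (distribʳ x 1# 1#) (cong₂ _+_ (*-identityˡ x) (*-identityˡ x))

  -x≡x⇒x≡0 : 1# + 1# ≢ 0# → ∀ {x} → - x ≡ x → x ≡ 0#
  -x≡x⇒x≡0 1+1≢0 {x} -x≡x = x*y≡0⇒y≡0 1+1≢0 (begin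
    (1# + 1#) * x    ≡⟨ [1+1]*x≡x+x x ⟩
    x + x            ≡⟨ cong (_+ x) -x≡x ⟨
    - x + x          ≡⟨ -‿inverseˡ x ⟩
    0#               ∎)
    where open ≡-Reasoning

  x+x≡0 : 1# + 1# ≡ 0# → ∀ x → x + x ≡ 0#
  x+x≡0 1+1≡0 x = begin
    x + x            ≡⟨ [1+1]*x≡x+x x ⟨
    (1# + 1#) * x    ≡⟨ cong (_* x) 1+1≡0 ⟩
    0# * x           ≡⟨ zeroˡ x ⟩
    0#               ∎
    where open ≡-Reasoning

  -- In odd characteristic, x ↦ - x fixes only 0# and so pairs up the other q - 1 elements.
  2∣q⇒1+1≡0 : 2 ∣ q → 1# + 1# ≡ 0#
  2∣q⇒1+1≡0 2∣q = decidable-stable (1# + 1# ≟ 0#) λ 1+1≢0 →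
    contradiction (∣1⇒≡1 (∣m+n∣m⇒∣n 2∣|nonzero|+1 (2∣|nonzero| 1+1≢0))) λ ()
    where
    open import Data.List.Membership.Propositional using (_∈_)
    open Inverse enum using (to; from; strictlyInverseʳ)
    open InvolutionParity _≟_ -_ -‿involutive
    elements nonzero : List Carrier
    elements = tabulate from
    nonzero = without 0# elements
    unique : Unique elements
    unique = Unique.tabulate⁺ (Injection.injective (↔⇒↣ (↔-sym enum)))
    ∈-elements : ∀ x → x ∈ elements
    ∈-elements x = subst (_∈ elements) (strictlyInverseʳ x) (∈-tabulate⁺ (to x))
    2∣|nonzero|+1 : 2 ∣ length nonzero ℕ.+ 1
    2∣|nonzero|+1 = subst (2 ∣_) (trans (sym |nonzero|+1) (ℕ.+-comm 1 _)) 2∣q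
      where
      |nonzero|+1 : suc (length nonzero) ≡ q
      |nonzero|+1 = trans (length-without unique (∈-elements 0#)) (length-tabulate from)
    2∣|nonzero| : 1# + 1# ≢ 0# → 2 ∣ length nonzero
    2∣|nonzero| 1+1≢0 = fixedPointFree⇒even _ nonzero refl (Unique.filter⁺ (_≢? 0#) unique)
      (λ {x} x∈ → ∈-filter⁺ (_≢? 0#) (∈-elements (- x)) (nonzero⇒≢0 x∈ ∘ -x≡0⇒x≡0))
      (λ x∈ → nonzero⇒≢0 x∈ ∘ -x≡x⇒x≡0 1+1≢0)
      where
      nonzero⇒≢0 : ∀ {x} → x ∈ nonzero → x ≢ 0#
      nonzero⇒≢0 = proj₂ ∘ ∈-filter⁻ (_≢? 0#) {xs = elements}

  root-unique : ∀ {α β} → ¬ (α ≡ 0# × β ≡ 0#) → ∃[ t₀ ] ∀ t → α + t * β ≡ 0# → t ≡ t₀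
  root-unique {α} {β} α,β≢0 with β ≟ 0#
  ... | yes β≡0 = 0# , λ t α+tβ≡0 → contradiction (α≡0 t α+tβ≡0 , β≡0) α,β≢0
    where
    α≡0 : ∀ t → α + t * β ≡ 0# → α ≡ 0#
    α≡0 t α+tβ≡0 = begin
      α              ≡⟨ +-identityʳ α ⟨
      α + 0#         ≡⟨ cong (α +_) (trans (cong (t *_) β≡0) (zeroʳ t)) ⟨
      α + t * β      ≡⟨ α+tβ≡0 ⟩
      0#             ∎
      where open ≡-Reasoning
  ... | no β≢0 = - (α * inv β β≢0) , λ t α+tβ≡0 → begin
    t                       ≡⟨ *-solveˡ β β≢0 (trans (sym (+-inverseʳ-unique α (t * β) α+tβ≡0)) (*-comm t β)) ⟩
    inv β β≢0 * - α         ≡⟨ *-comm _ _ ⟩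
    - α * inv β β≢0         ≡⟨ -‿distribˡ-* α _ ⟨
    - (α * inv β β≢0)       ∎
    where open ≡-Reasoning

  module _ {n} (n<q : n < q) where
    private
      element : Fin (suc n) → Carrier
      element j = Inverse.from enum (Fin.inject≤ j n<q)

      element-injective : ∀ {i j} → element i ≡ element j → i ≡ j
      element-injective = Fin.inject≤-injective n<q n<q _ _ ∘ Injection.injective (↔⇒↣ (↔-sym enum))

      avoids? : ∀ {m} (b : Fin m → Carrier) t → Dec (∀ i → t ≢ b i)
      avoids? b t = Fin.all? (λ i → ¬? (t ≟ b i))

      hit : ∀ (b : Fin n → Carrier) → ¬ (∃[ j ] ∀ i → element j ≢ b i) → ∀ j → ∃[ i ] element j ≡ b i
      hit b ¬avoids j with i , ¬≢ ← Fin.¬∀⟶∃¬ n (λ i → element j ≢ b i) (λ i → ¬? (element j ≟ b i)) (¬avoids ∘ (j ,_))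
        = i , decidable-stable (element j ≟ b i) ¬≢

    avoid : (b : Fin n → Carrier) → ∃[ t ] ∀ i → t ≢ b i
    avoid b with Fin.any? (λ j → avoids? b (element j))
    ... | yes (j , j-avoids) = element j , j-avoids
    ... | no ¬avoids with i , j , i<j , same-index ← Fin.pigeonhole ℕ.≤-refl (proj₁ ∘ hit b ¬avoids)
      = contradiction (element-injective (begin
        element i      ≡⟨ proj₂ (hit b ¬avoids i) ⟩
        b (index i)    ≡⟨ cong b same-index ⟩
        b (index j)    ≡⟨ proj₂ (hit b ¬avoids j) ⟨
        element j      ∎)) (Fin.<⇒≢ i<j)
      where
      open ≡-Reasoning
      index : Fin (suc n) → Fin n
      index = proj₁ ∘ hit b ¬avoids

module ProjectivePlane {q} (F : FiniteField q) where
  open FiniteField F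
  open FieldProperties F
  open Plane F
  open TripleAlgebra (CommutativeRing.rawRing commutativeRing) public
  -- Identities between triples are proved by `solve` on the same expressions over polynomials.
  private
    module P {n} = TripleAlgebra (polynomialRawRing n)

  ∙-comm : ∀ u v → u ∙ v ≡ v ∙ u
  ∙-comm u v = cong₂ _+_ (cong₂ _+_ (*-comm _ _) (*-comm _ _)) (*-comm _ _)

  ∙-distribʳ-⊕ : ∀ u v w → u ∙ (v ⊕ w) ≡ u ∙ v + u ∙ w
  ∙-distribʳ-⊕ u v w = solve 9 (λ u₀ u₁ u₂ v₀ v₁ v₂ w₀ w₁ w₂ →
    let u = P.triple u₀ u₁ u₂; v = P.triple v₀ v₁ v₂; w = P.triple w₀ w₁ w₂ in
    u P.∙ (v P.⊕ w) := u P.∙ v :+ u P.∙ w)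
    refl (t₀ u) (t₁ u) (t₂ u) (t₀ v) (t₁ v) (t₂ v) (t₀ w) (t₁ w) (t₂ w)

  ∙-scaleʳ : ∀ u c v → u ∙ (c ⊛ v) ≡ c * (u ∙ v)
  ∙-scaleʳ u c v = solve 7 (λ u₀ u₁ u₂ c v₀ v₁ v₂ →
    let u = P.triple u₀ u₁ u₂; v = P.triple v₀ v₁ v₂ in
    u P.∙ (c P.⊛ v) := c :* (u P.∙ v))
    refl (t₀ u) (t₁ u) (t₂ u) c (t₀ v) (t₁ v) (t₂ v)

  ⨯-orthogonalˡ : ∀ u v → u ⨯ v ∙ u ≡ 0#
  ⨯-orthogonalˡ u v = solve 6 (λ u₀ u₁ u₂ v₀ v₁ v₂ →
    let u = P.triple u₀ u₁ u₂; v = P.triple v₀ v₁ v₂ in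
    u P.⨯ v P.∙ u := con (ℤ.+ 0))
    refl (t₀ u) (t₁ u) (t₂ u) (t₀ v) (t₁ v) (t₂ v)

  ⨯-orthogonalʳ : ∀ u v → u ⨯ v ∙ v ≡ 0#
  ⨯-orthogonalʳ u v = solve 6 (λ u₀ u₁ u₂ v₀ v₁ v₂ →
    let u = P.triple u₀ u₁ u₂; v = P.triple v₀ v₁ v₂ in
    u P.⨯ v P.∙ v := con (ℤ.+ 0))
    refl (t₀ u) (t₁ u) (t₂ u) (t₀ v) (t₁ v) (t₂ v)

  ⨯-⨯-expand : ∀ i u v w → coord i (u ⨯ (v ⨯ w)) ≡ coord i v * (u ∙ w) - coord i w * (u ∙ v)
  ⨯-⨯-expand i u v w = expand i (t₀ u) (t₁ u) (t₂ u) (t₀ v) (t₁ v) (t₂ v) (t₀ w) (t₁ w) (t₂ w)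
    where
    identity : Fin 3 → N-ary 9 (Polynomial 9) (Polynomial 9 × Polynomial 9)
    identity i u₀ u₁ u₂ v₀ v₁ v₂ w₀ w₁ w₂ =
      let u = P.triple u₀ u₁ u₂; v = P.triple v₀ v₁ v₂; w = P.triple w₀ w₁ w₂ in
      P.coord i (u P.⨯ (v P.⨯ w)) := P.coord i v :* (u P.∙ w) :- P.coord i w :* (u P.∙ v)
    expand : ∀ i u₀ u₁ u₂ v₀ v₁ v₂ w₀ w₁ w₂ →
      let u = triple u₀ u₁ u₂; v = triple v₀ v₁ v₂; w = triple w₀ w₁ w₂ in
      coord i (u ⨯ (v ⨯ w)) ≡ coord i v * (u ∙ w) - coord i w * (u ∙ v)
    expand zero             = solve 9 (identity zero) refl
    expand (suc zero)       = solve 9 (identity (suc zero)) refl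
    expand (suc (suc zero)) = solve 9 (identity (suc (suc zero))) refl

  -- With these representatives the third diagonal point of the quadrangle abcd is
  -- C₁ = A″ + B₁ + 2β c, so in characteristic 2 it lies on the line A″B₁ (Fano's theorem).
  diagonal-identity : ∀ i a b c d → let β = a ⨯ d ∙ b in
    coord i ((c ⨯ d) ⨯ (a ⨯ b)) ≡ coord i ((a ⨯ d) ⨯ (b ⨯ c) ⊕ (b ⨯ d) ⨯ (c ⨯ a) ⊕ (β + β) ⊛ c)
  diagonal-identity i a b c d =
    identity i (t₀ a) (t₁ a) (t₂ a) (t₀ b) (t₁ b) (t₂ b) (t₀ c) (t₁ c) (t₂ c) (t₀ d) (t₁ d) (t₂ d)
    where
    polynomials : Fin 3 → N-ary 12 (Polynomial 12) (Polynomial 12 × Polynomial 12)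
    polynomials i a₀ a₁ a₂ b₀ b₁ b₂ c₀ c₁ c₂ d₀ d₁ d₂ =
      let a = P.triple a₀ a₁ a₂; b = P.triple b₀ b₁ b₂; c = P.triple c₀ c₁ c₂; d = P.triple d₀ d₁ d₂
          β = a P.⨯ d P.∙ b in
      P.coord i ((c P.⨯ d) P.⨯ (a P.⨯ b))
        := P.coord i ((a P.⨯ d) P.⨯ (b P.⨯ c) P.⊕ (b P.⨯ d) P.⨯ (c P.⨯ a) P.⊕ (β :+ β) P.⊛ c)
    identity : ∀ i a₀ a₁ a₂ b₀ b₁ b₂ c₀ c₁ c₂ d₀ d₁ d₂ →
      let a = triple a₀ a₁ a₂; b = triple b₀ b₁ b₂; c = triple c₀ c₁ c₂; d = triple d₀ d₁ d₂
          β = a ⨯ d ∙ b in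
      coord i ((c ⨯ d) ⨯ (a ⨯ b)) ≡ coord i ((a ⨯ d) ⨯ (b ⨯ c) ⊕ (b ⨯ d) ⨯ (c ⨯ a) ⊕ (β + β) ⊛ c)
    identity zero             = solve 12 (polynomials zero) refl
    identity (suc zero)       = solve 12 (polynomials (suc zero)) refl
    identity (suc (suc zero)) = solve 12 (polynomials (suc (suc zero))) refl

  diagonal-points-collinear : 1# + 1# ≡ 0# → ∀ a b c d → let A″ = (a ⨯ d) ⨯ (b ⨯ c); B₁ = (b ⨯ d) ⨯ (c ⨯ a) in
    A″ ⨯ B₁ ∙ (c ⨯ d) ⨯ (a ⨯ b) ≡ 0#
  diagonal-points-collinear 1+1≡0 a b c d = begin
    W ∙ (c ⨯ d) ⨯ (a ⨯ b)                  ≡⟨ cong (W ∙_) (coord-ext (λ i → diagonal-identity i a b c d)) ⟩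
    W ∙ (A″ ⊕ B₁ ⊕ (β + β) ⊛ c)            ≡⟨ ∙-distribʳ-⊕ W (A″ ⊕ B₁) _ ⟩
    W ∙ (A″ ⊕ B₁) + W ∙ ((β + β) ⊛ c)      ≡⟨ cong₂ _+_ (∙-distribʳ-⊕ W A″ B₁) (∙-scaleʳ W _ c) ⟩
    W ∙ A″ + W ∙ B₁ + (β + β) * (W ∙ c)    ≡⟨ cong₂ _+_ (cong₂ _+_ (⨯-orthogonalˡ A″ B₁) (⨯-orthogonalʳ A″ B₁))
                                                        (cong (_* (W ∙ c)) (x+x≡0 1+1≡0 β)) ⟩
    0# + 0# + 0# * (W ∙ c)                 ≡⟨ cong₂ _+_ (+-identityˡ 0#) (zeroˡ _) ⟩
    0# + 0#                                ≡⟨ +-identityˡ 0# ⟩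
    0#                                     ∎
    where
    open ≡-Reasoning
    A″ B₁ W : Triple
    A″ = (a ⨯ d) ⨯ (b ⨯ c)
    B₁ = (b ⨯ d) ⨯ (c ⨯ a)
    W  = A″ ⨯ B₁
    β : Carrier
    β  = a ⨯ d ∙ b

  ⌊_⌋ : Vec3 → Triple
  ⌊ u ⌋ = triple (x₀ u) (x₁ u) (x₂ u)

  infix 8 _·_
  _·_ : Vec3 → Vec3 → Carrier
  ℓ · P = ⌊ ℓ ⌋ ∙ ⌊ P ⌋

  ~-sym : ∀ {u v} → u ~ v → v ~ u
  ~-sym (c , c≢0 , e₀ , e₁ , e₂) =
    inv c c≢0 , inv-nonzero c c≢0 , *-solveˡ c c≢0 e₀ , *-solveˡ c c≢0 e₁ , *-solveˡ c c≢0 e₂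

  ~-trans : ∀ {u v w} → u ~ v → v ~ w → u ~ w
  ~-trans (c , c≢0 , e₀ , e₁ , e₂) (d , d≢0 , f₀ , f₁ , f₂) =
    c * d , *-nonzero c≢0 d≢0 , rescale e₀ f₀ , rescale e₁ f₁ , rescale e₂ f₂
    where
    rescale : ∀ {x y z} → x ≡ c * y → y ≡ d * z → x ≡ (c * d) * z
    rescale x≡cy y≡dz = trans x≡cy (trans (cong (c *_) y≡dz) (sym (*-assoc _ _ _)))

  scalar-multiple⇒~ : ∀ {u v} c → ⌊ u ⌋ ≡ c ⊛ ⌊ v ⌋ → u ~ v
  scalar-multiple⇒~ {u} {v} c refl = c , c≢0 , refl , refl , refl
    where
    c≢0 : c ≢ 0#
    c≢0 c≡0 = nonzero u (vanishes (x₀ v) , vanishes (x₁ v) , vanishes (x₂ v))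
      where
      vanishes : ∀ x → c * x ≡ 0#
      vanishes x = trans (cong (_* x) c≡0) (zeroˡ x)

  -- The wrappers make points and lines inferable from proofs: _~_ and _∈ₗ_ unfold to
  -- Σ-types and equations between coordinates, from which Agda cannot recover them.
  infix 4 _≃_ _∈_
  record _≃_ (u v : Vec3) : Set where
    constructor wrap
    field unwrap : u ~ v
  open _≃_ public

  record _∈_ (P ℓ : Vec3) : Set where
    constructor inc
    field uninc : P ∈ₗ ℓ
  open _∈_ public

  ≃-sym : ∀ {u v} → u ≃ v → v ≃ u
  ≃-sym {u} {v} (wrap u~v) = wrap (~-sym {u} {v} u~v)

  ≃-trans : ∀ {u v w} → u ≃ v → v ≃ w → u ≃ w
  ≃-trans {u} {v} {w} (wrap u~v) (wrap v~w) = wrap (~-trans {u} {v} {w} u~v v~w)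

  ∈-respˡ : ∀ {P P′ ℓ} → P ≃ P′ → P ∈ ℓ → P′ ∈ ℓ
  ∈-respˡ {P} {P′} {ℓ} (wrap (t , t≢0 , refl , refl , refl)) (inc P∈ℓ) =
    inc (x*y≡0⇒y≡0 t≢0 (trans (sym (∙-scaleʳ ⌊ ℓ ⌋ t ⌊ P′ ⌋)) P∈ℓ))

  ∈-dual : ∀ {P ℓ} → P ∈ ℓ → ℓ ∈ P
  ∈-dual {P} {ℓ} (inc P∈ℓ) = inc (trans (∙-comm ⌊ P ⌋ ⌊ ℓ ⌋) P∈ℓ)

  ∈-respʳ : ∀ {P ℓ ℓ′} → ℓ ≃ ℓ′ → P ∈ ℓ → P ∈ ℓ′
  ∈-respʳ ℓ≃ℓ′ = ∈-dual ∘ ∈-respˡ ℓ≃ℓ′ ∘ ∈-dual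

  infix 4 _∈?_
  _∈?_ : ∀ P ℓ → Dec (P ∈ ℓ)
  P ∈? ℓ = map′ inc uninc (ℓ · P ≟ 0#)

  distinct-lines : ∀ {P m m′} → P ∈ m → ¬ P ∈ m′ → ¬ m ≃ m′
  distinct-lines P∈m P∉m′ m≃m′ = P∉m′ (∈-respʳ m≃m′ P∈m)

  distinct-points : ∀ {P P′ m} → P ∈ m → ¬ P′ ∈ m → ¬ P ≃ P′
  distinct-points P∈m P′∉m P≃P′ = P′∉m (∈-respˡ P≃P′ P∈m)

  cross≡0⇒~ : ∀ u v → (∀ i → coord i (⌊ u ⌋ ⨯ ⌊ v ⌋) ≡ 0#) → u ~ v
  cross≡0⇒~ u v u⨯v≡0 = proportional
    (x∙y⁻¹≈ε⇒x≈y _ _ (u⨯v≡0 zero)) (x∙y⁻¹≈ε⇒x≈y _ _ (u⨯v≡0 (suc zero))) (x∙y⁻¹≈ε⇒x≈y _ _ (u⨯v≡0 (suc (suc zero))))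
    where
    proportional : x₁ u * x₂ v ≡ x₂ u * x₁ v → x₂ u * x₀ v ≡ x₀ u * x₂ v → x₀ u * x₁ v ≡ x₁ u * x₀ v → u ~ v
    proportional e₀ e₁ e₂ with x₀ v ≟ 0# | x₁ v ≟ 0# | x₂ v ≟ 0#
    ... | no v₀≢0 | _ | _ = scalar-multiple⇒~ {u} {v} _
      (triple-cong (*-ratio v₀≢0 refl) (*-ratio v₀≢0 (sym e₂)) (*-ratio v₀≢0 e₁))
    ... | yes _ | no v₁≢0 | _ = scalar-multiple⇒~ {u} {v} _
      (triple-cong (*-ratio v₁≢0 e₂) (*-ratio v₁≢0 refl) (*-ratio v₁≢0 (sym e₀)))
    ... | yes _ | yes _ | no v₂≢0 = scalar-multiple⇒~ {u} {v} _
      (triple-cong (*-ratio v₂≢0 (sym e₁)) (*-ratio v₂≢0 e₀) (*-ratio v₂≢0 refl))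
    ... | yes v₀≡0 | yes v₁≡0 | yes v₂≡0 = contradiction (v₀≡0 , v₁≡0 , v₂≡0) (nonzero v)

  cross : ∀ u v → ¬ u ≃ v → Vec3
  cross u v u≄v = record
    { x₀ = t₀ (⌊ u ⌋ ⨯ ⌊ v ⌋) ; x₁ = t₁ (⌊ u ⌋ ⨯ ⌊ v ⌋) ; x₂ = t₂ (⌊ u ⌋ ⨯ ⌊ v ⌋)
    ; nonzero = λ (c₀ , c₁ , c₂) →
        u≄v (wrap (cross≡0⇒~ u v λ { zero → c₀ ; (suc zero) → c₁ ; (suc (suc zero)) → c₂ })) }

  ∈-crossˡ : ∀ {u v} (u≄v : ¬ u ≃ v) → u ∈ cross u v u≄v
  ∈-crossˡ {u} {v} _ = inc (⨯-orthogonalˡ ⌊ u ⌋ ⌊ v ⌋)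

  ∈-crossʳ : ∀ {u v} (u≄v : ¬ u ≃ v) → v ∈ cross u v u≄v
  ∈-crossʳ {u} {v} _ = inc (⨯-orthogonalʳ ⌊ u ⌋ ⌊ v ⌋)

  cross-∈ˡ : ∀ {m m′} (m≄m′ : ¬ m ≃ m′) → cross m m′ m≄m′ ∈ m
  cross-∈ˡ = ∈-dual ∘ ∈-crossˡ

  cross-∈ʳ : ∀ {m m′} (m≄m′ : ¬ m ≃ m′) → cross m m′ m≄m′ ∈ m′
  cross-∈ʳ = ∈-dual ∘ ∈-crossʳ

  cross-unique : ∀ {ℓ X Y} (X≄Y : ¬ X ≃ Y) → X ∈ ℓ → Y ∈ ℓ → ℓ ≃ cross X Y X≄Y
  cross-unique {ℓ} {X} {Y} X≄Y (inc X∈ℓ) (inc Y∈ℓ) = wrap (cross≡0⇒~ ℓ (cross X Y X≄Y) λ i → begin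
    coord i (⌊ ℓ ⌋ ⨯ (⌊ X ⌋ ⨯ ⌊ Y ⌋))              ≡⟨ ⨯-⨯-expand i ⌊ ℓ ⌋ ⌊ X ⌋ ⌊ Y ⌋ ⟩
    coord i ⌊ X ⌋ * (ℓ · Y) - coord i ⌊ Y ⌋ * (ℓ · X)
      ≡⟨ cong₂ (λ s t → coord i ⌊ X ⌋ * s - coord i ⌊ Y ⌋ * t) Y∈ℓ X∈ℓ ⟩
    coord i ⌊ X ⌋ * 0# - coord i ⌊ Y ⌋ * 0#          ≡⟨ cong₂ _-_ (zeroʳ _) (zeroʳ _) ⟩
    0# - 0#                                          ≡⟨ -‿inverseʳ 0# ⟩
    0#                                               ∎)
    where open ≡-Reasoning

  line-unique : ∀ {X Y m m′} → ¬ X ≃ Y → X ∈ m → Y ∈ m → X ∈ m′ → Y ∈ m′ → m ≃ m′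
  line-unique X≄Y X∈m Y∈m X∈m′ Y∈m′ = ≃-trans (cross-unique X≄Y X∈m Y∈m) (≃-sym (cross-unique X≄Y X∈m′ Y∈m′))

  point-unique : ∀ {X Y m m′} → ¬ m ≃ m′ → X ∈ m → X ∈ m′ → Y ∈ m → Y ∈ m′ → X ≃ Y
  point-unique m≄m′ X∈m X∈m′ Y∈m Y∈m′ = line-unique m≄m′ (∈-dual X∈m) (∈-dual X∈m′) (∈-dual Y∈m) (∈-dual Y∈m′)

  fano : 1# + 1# ≡ 0# → ∀ {a b c d}
    (a≄d : ¬ a ≃ d) (b≄c : ¬ b ≃ c) (ad≄bc : ¬ cross a d a≄d ≃ cross b c b≄c)
    (b≄d : ¬ b ≃ d) (c≄a : ¬ c ≃ a) (bd≄ca : ¬ cross b d b≄d ≃ cross c a c≄a)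
    (c≄d : ¬ c ≃ d) (a≄b : ¬ a ≃ b) (cd≄ab : ¬ cross c d c≄d ≃ cross a b a≄b) →
    let A″ = cross (cross a d a≄d) (cross b c b≄c) ad≄bc
        B₁ = cross (cross b d b≄d) (cross c a c≄a) bd≄ca in
    (A″≄B₁ : ¬ A″ ≃ B₁) → cross (cross c d c≄d) (cross a b a≄b) cd≄ab ∈ cross A″ B₁ A″≄B₁
  fano 1+1≡0 {a} {b} {c} {d} _ _ _ _ _ _ _ _ _ _ = inc (diagonal-points-collinear 1+1≡0 ⌊ a ⌋ ⌊ b ⌋ ⌊ c ⌋ ⌊ d ⌋)

  unit : Fin 3 → Point
  unit zero             = ⟨ 1# , 0# , 0# ⟩ (λ (1≡0 , _) → 1≢0 1≡0)
  unit (suc zero)       = ⟨ 0# , 1# , 0# ⟩ (λ (_ , 1≡0 , _) → 1≢0 1≡0)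
  unit (suc (suc zero)) = ⟨ 0# , 0# , 1# ⟩ (λ (_ , _ , 1≡0) → 1≢0 1≡0)

  ·-unit : ∀ r i → r · unit i ≡ coord i ⌊ r ⌋
  ·-unit r zero = begin
    x₀ r * 1# + x₁ r * 0# + x₂ r * 0#  ≡⟨ cong₂ _+_ (cong₂ _+_ (*-identityʳ _) (zeroʳ _)) (zeroʳ _) ⟩
    x₀ r + 0# + 0#                     ≡⟨ trans (+-identityʳ _) (+-identityʳ _) ⟩
    x₀ r                               ∎
    where open ≡-Reasoning
  ·-unit r (suc zero) = begin
    x₀ r * 0# + x₁ r * 1# + x₂ r * 0#  ≡⟨ cong₂ _+_ (cong₂ _+_ (zeroʳ _) (*-identityʳ _)) (zeroʳ _) ⟩
    0# + x₁ r + 0#                     ≡⟨ trans (+-identityʳ _) (+-identityˡ _) ⟩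
    x₁ r                               ∎
    where open ≡-Reasoning
  ·-unit r (suc (suc zero)) = begin
    x₀ r * 0# + x₁ r * 0# + x₂ r * 1#  ≡⟨ cong₂ _+_ (cong₂ _+_ (zeroʳ _) (zeroʳ _)) (*-identityʳ _) ⟩
    0# + 0# + x₂ r                     ≡⟨ trans (cong (_+ x₂ r) (+-identityʳ 0#)) (+-identityˡ _) ⟩
    x₂ r                               ∎
    where open ≡-Reasoning

  point-off : ∀ r → ∃[ E ] ¬ E ∈ r
  point-off r with x₀ r ≟ 0# | x₁ r ≟ 0# | x₂ r ≟ 0#
  ... | no r₀≢0 | _ | _         = unit zero , r₀≢0 ∘ trans (sym (·-unit r zero)) ∘ uninc
  ... | yes _ | no r₁≢0 | _     = unit (suc zero) , r₁≢0 ∘ trans (sym (·-unit r (suc zero))) ∘ uninc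
  ... | yes _ | yes _ | no r₂≢0 = unit (suc (suc zero)) , r₂≢0 ∘ trans (sym (·-unit r (suc (suc zero)))) ∘ uninc
  ... | yes r₀≡0 | yes r₁≡0 | yes r₂≡0 = contradiction (r₀≡0 , r₁≡0 , r₂≡0) (nonzero r)

  line-through-other-than : ∀ {P r} → P ∈ r → ∃[ ℓ ] (P ∈ ℓ × ¬ ℓ ≃ r)
  line-through-other-than {P} {r} P∈r = cross P E P≄E , ∈-crossˡ P≄E , distinct-lines (∈-crossʳ P≄E) E∉r
    where
    E : Point
    E = proj₁ (point-off r)
    E∉r : ¬ E ∈ r
    E∉r = proj₂ (point-off r)
    P≄E : ¬ P ≃ E
    P≄E = distinct-points P∈r E∉r

  along : ∀ V P → Carrier → ¬ V ≃ P → Vec3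
  along V P t V≄P = record
    { x₀ = x₀ V + t * x₀ P ; x₁ = x₁ V + t * x₁ P ; x₂ = x₂ V + t * x₂ P
    ; nonzero = λ (e₀ , e₁ , e₂) →
        V≄P (wrap (scalar-multiple⇒~ {V} {P} (- t) (triple-cong (solved e₀) (solved e₁) (solved e₂)))) }
    where
    solved : ∀ {v p} → v + t * p ≡ 0# → v ≡ - t * p
    solved {v} {p} v+tp≡0 = trans (+-inverseˡ-unique v (t * p) v+tp≡0) (-‿distribˡ-* t p)

  ·-along : ∀ ℓ V P t (V≄P : ¬ V ≃ P) → ℓ · along V P t V≄P ≡ ℓ · V + t * (ℓ · P)
  ·-along ℓ V P t _ = trans (∙-distribʳ-⊕ ⌊ ℓ ⌋ ⌊ V ⌋ (t ⊛ ⌊ P ⌋)) (cong (ℓ · V +_) (∙-scaleʳ ⌊ ℓ ⌋ t ⌊ P ⌋))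

  along-∈ : ∀ {V P m t} (V≄P : ¬ V ≃ P) → V ∈ m → P ∈ m → along V P t V≄P ∈ m
  along-∈ {V} {P} {m} {t} V≄P (inc V∈m) (inc P∈m) = inc (begin
    m · along V P t V≄P    ≡⟨ ·-along m V P t V≄P ⟩
    m · V + t * (m · P)    ≡⟨ cong₂ (λ v p → v + t * p) V∈m P∈m ⟩
    0# + t * 0#            ≡⟨ trans (+-identityˡ _) (zeroʳ t) ⟩
    0#                     ∎)
    where open ≡-Reasoning

  along-∉ : ∀ {V P x t} (V≄P : ¬ V ≃ P) → ¬ V ∈ x → P ∈ x → ¬ along V P t V≄P ∈ x
  along-∉ {V} {P} {x} {t} V≄P V∉x (inc P∈x) (inc X∈x) = V∉x (inc (begin
    x · V                  ≡⟨ +-identityʳ _ ⟨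
    x · V + 0#             ≡⟨ cong (x · V +_) (trans (cong (t *_) P∈x) (zeroʳ t)) ⟨
    x · V + t * (x · P)    ≡⟨ ·-along x V P t V≄P ⟨
    x · along V P t V≄P    ≡⟨ X∈x ⟩
    0#                     ∎))
    where open ≡-Reasoning

  along-avoiding : ∀ {n} → n < q → ∀ {V P} (V≄P : ¬ V ≃ P) (ℓ : Fin n → Line) →
    (∀ i → ¬ (V ∈ ℓ i × P ∈ ℓ i)) → ∃[ t ] ∀ i → ¬ along V P t V≄P ∈ ℓ i
  along-avoiding n<q {V} {P} V≄P ℓ VP⊈ℓ = t , λ i (inc X∈ℓᵢ) →
    t≢root i (proj₂ (root i) t (trans (sym (·-along (ℓ i) V P t V≄P)) X∈ℓᵢ))
    where
    root : ∀ i → ∃[ t₀ ] ∀ t → ℓ i · V + t * (ℓ i · P) ≡ 0# → t ≡ t₀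
    root i = root-unique (λ (α≡0 , β≡0) → VP⊈ℓ i (inc α≡0 , inc β≡0))
    t : Carrier
    t = proj₁ (avoid n<q (proj₁ ∘ root))
    t≢root : ∀ i → t ≢ proj₁ (root i)
    t≢root = proj₂ (avoid n<q (proj₁ ∘ root))

  module _ (3<q : 3 < q) (S : Point → Set) {r P x y z w W}
    (P∈r : P ∈ r) (P∈x : P ∈ x) (P∉y : ¬ P ∈ y) (P∉z : ¬ P ∈ z)
    (x∩y⊈S : ∀ {X} → X ∈ x → X ∈ y → ¬ S X)
    (outside⊈S : ∀ {X} → ¬ X ∈ x → ¬ X ∈ y → ¬ X ∈ z → ¬ X ∈ w → ¬ S X)
    (W∈w : W ∈ w) (W∉S : ¬ S W) (W≄P : ¬ W ≃ P)
    {m} (P∈m : P ∈ m) (m≄r : ¬ m ≃ r) where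
    private
      m≄y : ¬ m ≃ y
      m≄y m≃y = P∉y (∈-respʳ m≃y P∈m)
      V : Point
      V = cross m y m≄y
      V∈m : V ∈ m
      V∈m = cross-∈ˡ m≄y
      V∈y : V ∈ y
      V∈y = cross-∈ʳ m≄y
      V≄P : ¬ V ≃ P
      V≄P V≃P = P∉y (∈-respˡ V≃P V∈y)
      off-r : ∀ {U} → ¬ U ≃ P → U ∈ m → ¬ U ∈ r
      off-r U≄P U∈m U∈r = m≄r (line-unique U≄P U∈m P∈m U∈r P∈r)

    -- The point sought is m ∩ y, or W, or a point V + t P of m avoiding y, z and w.
    affine-point-outside : ∃[ X ] (X ∈ m × ¬ X ∈ r × ¬ S X)
    affine-point-outside with V ∈? x | (V ∈? w) ×-dec (P ∈? w)
    ... | yes V∈x | _ = V , V∈m , off-r V≄P V∈m , x∩y⊈S V∈x V∈y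
    ... | no _ | yes (V∈w , P∈w) = W , W∈m , off-r W≄P W∈m , W∉S
      where
      W∈m : W ∈ m
      W∈m = ∈-respʳ (line-unique V≄P V∈w P∈w V∈m P∈m) W∈w
    ... | no V∉x | no VP⊈w = X , along-∈ V≄P V∈m P∈m , along-∉ V≄P (off-r V≄P V∈m) P∈r ,
      outside⊈S (along-∉ V≄P V∉x P∈x) (avoids zero) (avoids (suc zero)) (avoids (suc (suc zero)))
      where
      lines : Fin 3 → Line
      lines zero             = y
      lines (suc zero)       = z
      lines (suc (suc zero)) = w
      not-both : ∀ i → ¬ (V ∈ lines i × P ∈ lines i)
      not-both zero             = P∉y ∘ proj₂
      not-both (suc zero)       = P∉z ∘ proj₂
      not-both (suc (suc zero)) = VP⊈w
      X : Point
      X = along V P (proj₁ (along-avoiding 3<q V≄P lines not-both)) V≄P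
      avoids : ∀ i → ¬ X ∈ lines i
      avoids = proj₂ (along-avoiding 3<q V≄P lines not-both)

module KConstructionGeometry {q} (F : FiniteField q) {n} (K : Plane.KConstruction F (suc (suc n))) where
  open FiniteField F using (_+_; 1#; 0#)
  open Plane F
  open ProjectivePlane F
  open KConstruction K using (a; b; c; A; B; C; ℓ₀; A′; D)
  private module K = KConstruction K

  𝒦 : PointSet
  𝒦 = constructedSet K

  C∈a : C ∈ a
  C∈a = inc K.C∈a
  C∈b : C ∈ b
  C∈b = inc K.C∈b
  B∈a : B ∈ a
  B∈a = inc K.B∈a
  B∈c : B ∈ c
  B∈c = inc K.B∈c
  A∈b : A ∈ b
  A∈b = inc K.A∈b
  A∈c : A ∈ c
  A∈c = inc K.A∈c
  A∈ℓ₀ : A ∈ ℓ₀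
  A∈ℓ₀ = inc K.A∈ℓ₀
  A′∈ℓ₀ : A′ ∈ ℓ₀
  A′∈ℓ₀ = inc K.A′∈ℓ₀
  A′∈a : A′ ∈ a
  A′∈a = inc K.A′∈a
  D∈ℓ₀ : ∀ i → D i ∈ ℓ₀
  D∈ℓ₀ i = inc (K.D∈ℓ₀ i)

  non-concurrent : ∀ {X} → X ∈ a → X ∈ b → ¬ X ∈ c
  non-concurrent {X} (inc X∈a) (inc X∈b) (inc X∈c) = K.nonConcurrent (X , X∈a , X∈b , X∈c)

  A∉a : ¬ A ∈ a
  A∉a A∈a = non-concurrent A∈a A∈b A∈c
  B∉b : ¬ B ∈ b
  B∉b B∈b = non-concurrent B∈a B∈b B∈c
  C∉c : ¬ C ∈ c
  C∉c = non-concurrent C∈a C∈b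

  a≄b : ¬ a ≃ b
  a≄b a≃b = A∉a (∈-respʳ (≃-sym a≃b) A∈b)
  a≄c : ¬ a ≃ c
  a≄c a≃c = A∉a (∈-respʳ (≃-sym a≃c) A∈c)
  a≄ℓ₀ : ¬ a ≃ ℓ₀
  a≄ℓ₀ a≃ℓ₀ = A∉a (∈-respʳ (≃-sym a≃ℓ₀) A∈ℓ₀)
  ℓ₀≄b : ¬ ℓ₀ ≃ b
  ℓ₀≄b = K.ℓ₀≁b ∘ unwrap
  ℓ₀≄c : ¬ ℓ₀ ≃ c
  ℓ₀≄c = K.ℓ₀≁c ∘ unwrap

  A≄B : ¬ A ≃ B
  A≄B = distinct-points A∈b B∉b
  A≄C : ¬ A ≃ C
  A≄C = distinct-points A∈c C∉c
  B≄C : ¬ B ≃ C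
  B≄C = distinct-points B∈c C∉c

  B∉ℓ₀ : ¬ B ∈ ℓ₀
  B∉ℓ₀ B∈ℓ₀ = A≄B (point-unique ℓ₀≄c A∈ℓ₀ A∈c B∈ℓ₀ B∈c)
  C∉ℓ₀ : ¬ C ∈ ℓ₀
  C∉ℓ₀ C∈ℓ₀ = A≄C (point-unique ℓ₀≄b A∈ℓ₀ A∈b C∈ℓ₀ C∈b)

  A′∉b : ¬ A′ ∈ b
  A′∉b A′∈b = C∉ℓ₀ (∈-respˡ (point-unique a≄b A′∈a A′∈b C∈a C∈b) A′∈ℓ₀)
  A′∉c : ¬ A′ ∈ c
  A′∉c A′∈c = B∉ℓ₀ (∈-respˡ (point-unique a≄c A′∈a A′∈c B∈a B∈c) A′∈ℓ₀)

  D≄A : ∀ i → ¬ D i ≃ A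
  D≄A i = K.D≁A i ∘ unwrap
  D≄B : ∀ i → ¬ D i ≃ B
  D≄B i = distinct-points (D∈ℓ₀ i) B∉ℓ₀
  D≄C : ∀ i → ¬ D i ≃ C
  D≄C i = distinct-points (D∈ℓ₀ i) C∉ℓ₀
  D∉a : ∀ i → ¬ D i ∈ a
  D∉a i Dᵢ∈a = K.D≁A′ i (unwrap (point-unique a≄ℓ₀ Dᵢ∈a (D∈ℓ₀ i) A′∈a A′∈ℓ₀))
  D∉b : ∀ i → ¬ D i ∈ b
  D∉b i Dᵢ∈b = D≄A i (point-unique ℓ₀≄b (D∈ℓ₀ i) Dᵢ∈b A∈ℓ₀ A∈b)
  D∉c : ∀ i → ¬ D i ∈ c
  D∉c i Dᵢ∈c = D≄A i (point-unique ℓ₀≄c (D∈ℓ₀ i) Dᵢ∈c A∈ℓ₀ A∈c)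

  data Location (X : Point) : Set where
    only-a : X ∈ a → ¬ X ∈ b → ¬ X ∈ c → Location X
    only-b : ¬ X ∈ a → X ∈ b → ¬ X ∈ c → Location X
    only-c : ¬ X ∈ a → ¬ X ∈ b → X ∈ c → Location X
    is-D   : ∀ i → X ≃ D i → Location X

  locate : ∀ {X} → 𝒦 X → Location X
  locate (inj₁ (inj₁ (X∈a , X∉b , X∉c)) , _)        = only-a (inc X∈a) (X∉b ∘ uninc) (X∉c ∘ uninc)
  locate (inj₁ (inj₂ (inj₁ (X∉a , X∈b , X∉c))) , _) = only-b (X∉a ∘ uninc) (inc X∈b) (X∉c ∘ uninc)
  locate (inj₁ (inj₂ (inj₂ (X∉a , X∉b , X∈c))) , _) = only-c (X∉a ∘ uninc) (X∉b ∘ uninc) (inc X∈c)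
  locate (inj₂ (i , X~Dᵢ) , _)                      = is-D i (wrap X~Dᵢ)

  removed-B : ∀ {X} i {m} → X ∈ b → B ∈ m → D i ∈ m → X ∈ m → ¬ 𝒦 X
  removed-B i {m} (inc X∈b) (inc B∈m) (inc Dᵢ∈m) (inc X∈m) (_ , ¬B , _) = ¬B (i , X∈b , m , B∈m , Dᵢ∈m , X∈m)

  removed-C : ∀ {X} i {m} → X ∈ c → C ∈ m → D i ∈ m → X ∈ m → ¬ 𝒦 X
  removed-C i {m} (inc X∈c) (inc C∈m) (inc Dᵢ∈m) (inc X∈m) (_ , _ , ¬C) = ¬C (i , X∈c , m , C∈m , Dᵢ∈m , X∈m)

  on-BD : ∀ {i X} → IsBᵢ K i X → X ∈ b × ∃[ ℓ ] (B ∈ ℓ × D i ∈ ℓ × X ∈ ℓ)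
  on-BD {i} {X} (X∈b , ℓ , B∈ℓ , Dᵢ∈ℓ , X∈ℓ) = inc X∈b , ℓ , inc {B} {ℓ} B∈ℓ , inc {D i} {ℓ} Dᵢ∈ℓ , inc {X} {ℓ} X∈ℓ

  on-CD : ∀ {i X} → IsCᵢ K i X → X ∈ c × ∃[ ℓ ] (C ∈ ℓ × D i ∈ ℓ × X ∈ ℓ)
  on-CD {i} {X} (X∈c , ℓ , C∈ℓ , Dᵢ∈ℓ , X∈ℓ) = inc X∈c , ℓ , inc {C} {ℓ} C∈ℓ , inc {D i} {ℓ} Dᵢ∈ℓ , inc {X} {ℓ} X∈ℓ

  a∩b⊈𝒦 : ∀ {X} → X ∈ a → X ∈ b → ¬ 𝒦 X
  a∩b⊈𝒦 X∈a X∈b X∈𝒦 with locate X∈𝒦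
  ... | only-a _ X∉b _ = X∉b X∈b
  ... | only-b X∉a _ _ = X∉a X∈a
  ... | only-c X∉a _ _ = X∉a X∈a
  ... | is-D i X≃Dᵢ    = D∉a i (∈-respˡ X≃Dᵢ X∈a)

  a∩c⊈𝒦 : ∀ {X} → X ∈ a → X ∈ c → ¬ 𝒦 X
  a∩c⊈𝒦 X∈a X∈c X∈𝒦 with locate X∈𝒦
  ... | only-a _ _ X∉c = X∉c X∈c
  ... | only-b X∉a _ _ = X∉a X∈a
  ... | only-c X∉a _ _ = X∉a X∈a
  ... | is-D i X≃Dᵢ    = D∉a i (∈-respˡ X≃Dᵢ X∈a)

  b∩c⊈𝒦 : ∀ {X} → X ∈ b → X ∈ c → ¬ 𝒦 X
  b∩c⊈𝒦 X∈b X∈c X∈𝒦 with locate X∈𝒦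
  ... | only-a _ X∉b _ = X∉b X∈b
  ... | only-b _ _ X∉c = X∉c X∈c
  ... | only-c _ X∉b _ = X∉b X∈b
  ... | is-D i X≃Dᵢ    = D∉b i (∈-respˡ X≃Dᵢ X∈b)

  A∉𝒦 : ¬ 𝒦 A
  A∉𝒦 = b∩c⊈𝒦 A∈b A∈c

  outside⊈𝒦 : ∀ {X} → ¬ X ∈ a → ¬ X ∈ b → ¬ X ∈ c → ¬ X ∈ ℓ₀ → ¬ 𝒦 X
  outside⊈𝒦 X∉a X∉b X∉c X∉ℓ₀ X∈𝒦 with locate X∈𝒦
  ... | only-a X∈a _ _ = X∉a X∈a
  ... | only-b _ X∈b _ = X∉b X∈b
  ... | only-c _ _ X∈c = X∉c X∈c
  ... | is-D i X≃Dᵢ    = X∉ℓ₀ (∈-respˡ (≃-sym X≃Dᵢ) (D∈ℓ₀ i))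

  TangentAt : Point → Set
  TangentAt Q = ∃[ m ] (Q ∈ m × ∀ {Y} → Y ∈ m → 𝒦 Y → Y ≃ Q)

  tangent-resp : ∀ {Q Q′} → Q ≃ Q′ → TangentAt Q′ → TangentAt Q
  tangent-resp Q≃Q′ (m , Q′∈m , unique) =
    m , ∈-respˡ (≃-sym Q≃Q′) Q′∈m , λ Y∈m Y∈𝒦 → ≃-trans (unique Y∈m Y∈𝒦) (≃-sym Q≃Q′)

  tangent-on-a : ∀ {Q} → Q ∈ a → ¬ Q ∈ b → ¬ Q ∈ c → ¬ Q ∈ ℓ₀ → TangentAt Q
  tangent-on-a {Q} Q∈a Q∉b Q∉c Q∉ℓ₀ = m , Q∈m , unique
    where
    Q≄A : ¬ Q ≃ A
    Q≄A = distinct-points Q∈a A∉a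
    m : Line
    m = cross Q A Q≄A
    Q∈m : Q ∈ m
    Q∈m = ∈-crossˡ Q≄A
    A∈m : A ∈ m
    A∈m = ∈-crossʳ Q≄A
    unique : ∀ {Y} → Y ∈ m → 𝒦 Y → Y ≃ Q
    unique Y∈m Y∈𝒦 with locate Y∈𝒦
    ... | only-a Y∈a _ _   = point-unique (distinct-lines A∈m A∉a) Y∈m Y∈a Q∈m Q∈a
    ... | only-b _ Y∈b Y∉c = contradiction (∈-respˡ (point-unique (distinct-lines Q∈m Q∉b) A∈m A∈b Y∈m Y∈b) A∈c) Y∉c
    ... | only-c _ Y∉b Y∈c = contradiction (∈-respˡ (point-unique (distinct-lines Q∈m Q∉c) A∈m A∈c Y∈m Y∈c) A∈b) Y∉b
    ... | is-D i Y≃Dᵢ      = contradiction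
      (point-unique (distinct-lines Q∈m Q∉ℓ₀) (∈-respˡ Y≃Dᵢ Y∈m) (D∈ℓ₀ i) A∈m A∈ℓ₀) (D≄A i)

  tangent-on-b : ∀ {Q} → 𝒦 Q → ¬ Q ∈ a → Q ∈ b → ¬ Q ∈ c → TangentAt Q
  tangent-on-b {Q} Q∈𝒦 Q∉a Q∈b Q∉c = m , Q∈m , unique
    where
    Q≄B : ¬ Q ≃ B
    Q≄B = distinct-points Q∈b B∉b
    m : Line
    m = cross Q B Q≄B
    Q∈m : Q ∈ m
    Q∈m = ∈-crossˡ Q≄B
    B∈m : B ∈ m
    B∈m = ∈-crossʳ Q≄B
    unique : ∀ {Y} → Y ∈ m → 𝒦 Y → Y ≃ Q
    unique Y∈m Y∈𝒦 with locate Y∈𝒦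
    ... | only-a Y∈a _ Y∉c = contradiction (∈-respˡ (point-unique (distinct-lines Q∈m Q∉a) B∈m B∈a Y∈m Y∈a) B∈c) Y∉c
    ... | only-b _ Y∈b _   = point-unique (distinct-lines B∈m B∉b) Y∈m Y∈b Q∈m Q∈b
    ... | only-c Y∉a _ Y∈c = contradiction (∈-respˡ (point-unique (distinct-lines Q∈m Q∉c) B∈m B∈c Y∈m Y∈c) B∈a) Y∉a
    ... | is-D i Y≃Dᵢ      = contradiction Q∈𝒦 (removed-B i Q∈b B∈m (∈-respˡ Y≃Dᵢ Y∈m) Q∈m)

  tangent-on-c : ∀ {Q} → 𝒦 Q → ¬ Q ∈ a → ¬ Q ∈ b → Q ∈ c → TangentAt Q
  tangent-on-c {Q} Q∈𝒦 Q∉a Q∉b Q∈c = m , Q∈m , unique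
    where
    Q≄C : ¬ Q ≃ C
    Q≄C = distinct-points Q∈c C∉c
    m : Line
    m = cross Q C Q≄C
    Q∈m : Q ∈ m
    Q∈m = ∈-crossˡ Q≄C
    C∈m : C ∈ m
    C∈m = ∈-crossʳ Q≄C
    unique : ∀ {Y} → Y ∈ m → 𝒦 Y → Y ≃ Q
    unique Y∈m Y∈𝒦 with locate Y∈𝒦
    ... | only-a Y∈a Y∉b _ = contradiction (∈-respˡ (point-unique (distinct-lines Q∈m Q∉a) C∈m C∈a Y∈m Y∈a) C∈b) Y∉b
    ... | only-b Y∉a Y∈b _ = contradiction (∈-respˡ (point-unique (distinct-lines Q∈m Q∉b) C∈m C∈b Y∈m Y∈b) C∈a) Y∉a
    ... | only-c _ _ Y∈c   = point-unique (distinct-lines C∈m C∉c) Y∈m Y∈c Q∈m Q∈c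
    ... | is-D i Y≃Dᵢ      = contradiction Q∈𝒦 (removed-C i Q∈c C∈m (∈-respˡ Y≃Dᵢ Y∈m) Q∈m)

  tangent-at-D : ∀ i → TangentAt (D i)
  tangent-at-D i = m , Dᵢ∈m , unique
    where
    m : Line
    m = cross (D i) B (D≄B i)
    Dᵢ∈m : D i ∈ m
    Dᵢ∈m = ∈-crossˡ (D≄B i)
    B∈m : B ∈ m
    B∈m = ∈-crossʳ (D≄B i)
    unique : ∀ {Y} → Y ∈ m → 𝒦 Y → Y ≃ D i
    unique Y∈m Y∈𝒦 with locate Y∈𝒦
    ... | only-a Y∈a _ Y∉c = contradiction (∈-respˡ (point-unique (distinct-lines Dᵢ∈m (D∉a i)) B∈m B∈a Y∈m Y∈a) B∈c) Y∉c
    ... | only-b _ Y∈b _   = contradiction Y∈𝒦 (removed-B i Y∈b B∈m Dᵢ∈m Y∈m)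
    ... | only-c Y∉a _ Y∈c = contradiction (∈-respˡ (point-unique (distinct-lines Dᵢ∈m (D∉c i)) B∈m B∈c Y∈m Y∈c) B∈a) Y∉a
    ... | is-D j Y≃Dⱼ      = point-unique (distinct-lines B∈m B∉ℓ₀) Y∈m (∈-respˡ (≃-sym Y≃Dⱼ) (D∈ℓ₀ j)) Dᵢ∈m (D∈ℓ₀ i)

  -- The tangent at A′: a line through A′ meeting b and c in deleted points.
  record Transversal : Set where
    field
      m : Line
      A′∈m : A′ ∈ m
      Bₘ Cₘ : Point
      Bₘ∈m : Bₘ ∈ m
      Cₘ∈m : Cₘ ∈ m
      Bₘ-removed : ∃[ i ] IsBᵢ K i Bₘ
      Cₘ-removed : ∃[ j ] IsCᵢ K j Cₘ

  tangent-at-A′ : Transversal → TangentAt A′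
  tangent-at-A′ T with Transversal.Bₘ-removed T | Transversal.Cₘ-removed T
  ... | i , isB | j , isC with on-BD isB | on-CD isC
  ... | Bₘ∈b , ℓ , B∈ℓ , Dᵢ∈ℓ , Bₘ∈ℓ | Cₘ∈c , ℓ′ , C∈ℓ′ , Dⱼ∈ℓ′ , Cₘ∈ℓ′ = m , A′∈m , unique
    where
    open Transversal T
    Bₘ∉a : ¬ Bₘ ∈ a
    Bₘ∉a Bₘ∈a = D∉a i (∈-respʳ (line-unique B≄C B∈ℓ C∈ℓ B∈a C∈a) Dᵢ∈ℓ)
      where
      C∈ℓ : C ∈ ℓ
      C∈ℓ = ∈-respˡ (point-unique a≄b Bₘ∈a Bₘ∈b C∈a C∈b) Bₘ∈ℓ
    Bₘ∉ℓ₀ : ¬ Bₘ ∈ ℓ₀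
    Bₘ∉ℓ₀ Bₘ∈ℓ₀ = D∉c i (∈-respʳ (line-unique A≄B A∈ℓ B∈ℓ A∈c B∈c) Dᵢ∈ℓ)
      where
      A∈ℓ : A ∈ ℓ
      A∈ℓ = ∈-respˡ (point-unique ℓ₀≄b Bₘ∈ℓ₀ Bₘ∈b A∈ℓ₀ A∈b) Bₘ∈ℓ
    unique : ∀ {Y} → Y ∈ m → 𝒦 Y → Y ≃ A′
    unique Y∈m Y∈𝒦 with locate Y∈𝒦
    ... | only-a Y∈a _ _ = point-unique (distinct-lines Bₘ∈m Bₘ∉a) Y∈m Y∈a A′∈m A′∈a
    ... | only-b _ Y∈b _ = contradiction Y∈𝒦 (removed-B i Y∈b B∈ℓ Dᵢ∈ℓ
                             (∈-respˡ (point-unique (distinct-lines A′∈m A′∉b) Bₘ∈m Bₘ∈b Y∈m Y∈b) Bₘ∈ℓ))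
    ... | only-c _ _ Y∈c = contradiction Y∈𝒦 (removed-C j Y∈c C∈ℓ′ Dⱼ∈ℓ′
                             (∈-respˡ (point-unique (distinct-lines A′∈m A′∉c) Cₘ∈m Cₘ∈c Y∈m Y∈c) Cₘ∈ℓ′))
    ... | is-D k Y≃Dₖ    = point-unique (distinct-lines Bₘ∈m Bₘ∉ℓ₀) Y∈m (∈-respˡ (≃-sym Y≃Dₖ) (D∈ℓ₀ k)) A′∈m A′∈ℓ₀

  tangent : Transversal → ∀ {Q} → 𝒦 Q → TangentAt Q
  tangent T {Q} Q∈𝒦 with locate Q∈𝒦
  ... | only-a Q∈a Q∉b Q∉c with Q ∈? ℓ₀
  ...   | no Q∉ℓ₀  = tangent-on-a Q∈a Q∉b Q∉c Q∉ℓ₀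
  ...   | yes Q∈ℓ₀ = tangent-resp (point-unique a≄ℓ₀ Q∈a Q∈ℓ₀ A′∈a A′∈ℓ₀) (tangent-at-A′ T)
  tangent T Q∈𝒦 | only-b Q∉a Q∈b Q∉c = tangent-on-b Q∈𝒦 Q∉a Q∈b Q∉c
  tangent T Q∈𝒦 | only-c Q∉a Q∉b Q∈c = tangent-on-c Q∈𝒦 Q∉a Q∉b Q∈c
  tangent T Q∈𝒦 | is-D i Q≃Dᵢ        = tangent-resp Q≃Dᵢ (tangent-at-D i)

  private
    D₁ : Point
    D₁ = D zero
    B≄D₁ : ¬ B ≃ D₁
    B≄D₁ = D≄B zero ∘ ≃-sym
    C≄A : ¬ C ≃ A
    C≄A = A≄C ∘ ≃-sym
    BD₁ CA : Line
    BD₁ = cross B D₁ B≄D₁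
    CA = cross C A C≄A
    b≃CA : b ≃ CA
    b≃CA = cross-unique C≄A C∈b A∈b
    BD₁≄CA : ¬ BD₁ ≃ CA
    BD₁≄CA = distinct-lines (∈-crossˡ B≄D₁) (B∉b ∘ ∈-respʳ (≃-sym b≃CA))
    B₁ : Point
    B₁ = cross BD₁ CA BD₁≄CA
    B₁∈b : B₁ ∈ b
    B₁∈b = ∈-respʳ (≃-sym b≃CA) (cross-∈ʳ BD₁≄CA)
    B₁-removed : IsBᵢ K zero B₁
    B₁-removed = uninc B₁∈b , BD₁ , uninc (∈-crossˡ B≄D₁) , uninc (∈-crossʳ B≄D₁) , uninc (cross-∈ˡ BD₁≄CA)

  odd-transversal : OddCondition K → Transversal
  odd-transversal odd = record
    { m = m ; A′∈m = ∈-crossˡ A′≄B₁ ; Bₘ = B₁ ; Cₘ = C₂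
    ; Bₘ∈m = ∈-crossʳ A′≄B₁ ; Cₘ∈m = cross-∈ˡ m≄c
    ; Bₘ-removed = zero , B₁-removed
    ; Cₘ-removed = suc zero , uninc (cross-∈ʳ m≄c) , C₂-on-CD₂ }
    where
    A′≄B₁ : ¬ A′ ≃ B₁
    A′≄B₁ A′≃B₁ = A′∉b (∈-respˡ (≃-sym A′≃B₁) B₁∈b)
    m : Line
    m = cross A′ B₁ A′≄B₁
    m≄c : ¬ m ≃ c
    m≄c = distinct-lines (∈-crossˡ A′≄B₁) A′∉c
    C₂ : Point
    C₂ = cross m c m≄c
    C₂-on-CD₂ : Collinear C (D (suc zero)) C₂
    C₂-on-CD₂ = swap (odd B₁ C₂ B₁-removed (uninc (cross-∈ʳ m≄c))
                     (m , uninc (∈-crossˡ A′≄B₁) , uninc (∈-crossʳ A′≄B₁) , uninc (cross-∈ˡ m≄c)))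
      where
      swap : Collinear C C₂ (D (suc zero)) → Collinear C (D (suc zero)) C₂
      swap (ℓ , C∈ℓ , C₂∈ℓ , D₂∈ℓ) = ℓ , C∈ℓ , D₂∈ℓ , C₂∈ℓ

  even-transversal : 1# + 1# ≡ 0# → Transversal
  even-transversal 1+1≡0 = record
    { m = m ; A′∈m = ∈-respˡ (≃-sym A′≃A″) (∈-crossˡ A″≄B₁) ; Bₘ = B₁ ; Cₘ = C₁
    ; Bₘ∈m = ∈-crossʳ A″≄B₁ ; Cₘ∈m = fano 1+1≡0 A≄D₁ B≄C AD₁≄BC B≄D₁ C≄A BD₁≄CA C≄D₁ A≄B CD₁≄AB A″≄B₁
    ; Bₘ-removed = zero , B₁-removed
    ; Cₘ-removed = zero , uninc (∈-respʳ (≃-sym c≃AB) (cross-∈ʳ CD₁≄AB)) , CD₁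
                  , uninc (∈-crossˡ C≄D₁) , uninc (∈-crossʳ C≄D₁) , uninc (cross-∈ˡ CD₁≄AB) }
    where
    A≄D₁ : ¬ A ≃ D₁
    A≄D₁ = D≄A zero ∘ ≃-sym
    AD₁ BC : Line
    AD₁ = cross A D₁ A≄D₁
    BC = cross B C B≄C
    ℓ₀≃AD₁ : ℓ₀ ≃ AD₁
    ℓ₀≃AD₁ = cross-unique A≄D₁ A∈ℓ₀ (D∈ℓ₀ zero)
    a≃BC : a ≃ BC
    a≃BC = cross-unique B≄C B∈a C∈a
    AD₁≄BC : ¬ AD₁ ≃ BC
    AD₁≄BC AD₁≃BC = a≄ℓ₀ (≃-trans a≃BC (≃-trans (≃-sym AD₁≃BC) (≃-sym ℓ₀≃AD₁)))
    A″ : Point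
    A″ = cross AD₁ BC AD₁≄BC
    A′≃A″ : A′ ≃ A″
    A′≃A″ = point-unique a≄ℓ₀ A′∈a A′∈ℓ₀
      (∈-respʳ (≃-sym a≃BC) (cross-∈ʳ AD₁≄BC)) (∈-respʳ (≃-sym ℓ₀≃AD₁) (cross-∈ˡ AD₁≄BC))
    A″≄B₁ : ¬ A″ ≃ B₁
    A″≄B₁ A″≃B₁ = A′∉b (∈-respˡ (≃-sym (≃-trans A′≃A″ A″≃B₁)) B₁∈b)
    m : Line
    m = cross A″ B₁ A″≄B₁
    C≄D₁ : ¬ C ≃ D₁
    C≄D₁ = D≄C zero ∘ ≃-sym
    CD₁ AB : Line
    CD₁ = cross C D₁ C≄D₁
    AB = cross A B A≄B
    c≃AB : c ≃ AB
    c≃AB = cross-unique A≄B A∈c B∈c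
    CD₁≄AB : ¬ CD₁ ≃ AB
    CD₁≄AB = distinct-lines (∈-crossˡ C≄D₁) (C∉c ∘ ∈-respʳ (≃-sym c≃AB))
    C₁ : Point
    C₁ = cross CD₁ AB CD₁≄AB

  affine-point-outside-𝒦 : 3 < q → ∀ {r P m} → P ∈ r → 𝒦 P → P ∈ m → ¬ m ≃ r → ∃[ X ] (X ∈ m × ¬ X ∈ r × ¬ 𝒦 X)
  affine-point-outside-𝒦 3<q P∈r P∈𝒦 with locate P∈𝒦
  ... | only-a P∈a P∉b P∉c = affine-point-outside 3<q 𝒦 P∈r P∈a P∉b P∉c a∩b⊈𝒦
                               outside⊈𝒦 A∈ℓ₀ A∉𝒦 (distinct-points A∈b P∉b)
  ... | only-b P∉a P∈b P∉c = affine-point-outside 3<q 𝒦 P∈r P∈b P∉a P∉c (λ X∈b X∈a → a∩b⊈𝒦 X∈a X∈b)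
                               (λ X∉b X∉a X∉c → outside⊈𝒦 X∉a X∉b X∉c) A∈ℓ₀ A∉𝒦 (distinct-points A∈c P∉c)
  ... | only-c P∉a P∉b P∈c = affine-point-outside 3<q 𝒦 P∈r P∈c P∉a P∉b (λ X∈c X∈a → a∩c⊈𝒦 X∈a X∈c)
                               (λ X∉c X∉a X∉b → outside⊈𝒦 X∉a X∉b X∉c) A∈ℓ₀ A∉𝒦 (distinct-points A∈b P∉b)
  ... | is-D i P≃Dᵢ = affine-point-outside 3<q 𝒦 P∈r (∈-respˡ (≃-sym P≃Dᵢ) (D∈ℓ₀ i))
                        (D∉b i ∘ ∈-respˡ P≃Dᵢ) (D∉a i ∘ ∈-respˡ P≃Dᵢ)
                        (λ X∈ℓ₀ X∈b → b∩c⊈𝒦 X∈b (∈-respˡ (≃-sym (point-unique ℓ₀≄b X∈ℓ₀ X∈b A∈ℓ₀ A∈b)) A∈c))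
                        (λ X∉ℓ₀ X∉b X∉a X∉c → outside⊈𝒦 X∉a X∉b X∉c X∉ℓ₀)
                        A∈c A∉𝒦 (λ A≃P → D≄A i (≃-sym (≃-trans A≃P P≃Dᵢ)))

m%2≡1⊎2∣m : ∀ m → m % 2 ≡ 1 ⊎ 2 ∣ m
m%2≡1⊎2∣m zero          = inj₂ (divides 0 refl)
m%2≡1⊎2∣m (suc zero)    = inj₁ refl
m%2≡1⊎2∣m (suc (suc m)) = Sum.map id (∣m∣n⇒∣m+n ∣-refl) (m%2≡1⊎2∣m m)

module AffineDirection {q} (F : FiniteField q) (r : Plane.Line F) where
  open Plane F
  open ProjectivePlane F
  open Affine r

  module _ {P ℓ} (P∈r : P ∈ r) (P∈ℓ : P ∈ ℓ) (ℓ≄r : ¬ ℓ ≃ r) where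
    ∌P⇒¬parallel : ∀ {m} → ¬ P ∈ m → ¬ Parallel ℓ m
    ∌P⇒¬parallel P∉m (inj₁ m~ℓ) = P∉m (∈-respʳ (≃-sym (wrap m~ℓ)) P∈ℓ)
    ∌P⇒¬parallel {m} P∉m (inj₂ no-common) =
      no-common (X , X∉r ∘ inc , uninc (cross-∈ʳ m≄ℓ) , uninc (cross-∈ˡ m≄ℓ))
      where
      m≄ℓ : ¬ m ≃ ℓ
      m≄ℓ = distinct-lines P∈ℓ P∉m ∘ ≃-sym
      X : Point
      X = cross m ℓ m≄ℓ
      X∉r : ¬ X ∈ r
      X∉r X∈r = P∉m (∈-respˡ (point-unique ℓ≄r (cross-∈ʳ m≄ℓ) X∈r P∈ℓ P∈r) (cross-∈ˡ m≄ℓ))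

    parallel⇒∋P : ∀ {m} → Parallel ℓ m → P ∈ m
    parallel⇒∋P {m} ℓ∥m with P ∈? m
    ... | yes P∈m = P∈m
    ... | no P∉m  = contradiction ℓ∥m (∌P⇒¬parallel P∉m)

    Π-property : ∀ {𝒦 ℬ′ : PointSet} → IsAffSet ℬ′ → (∀ {X} → ℬ′ X → 𝒦 X × ¬ X ~ P) → 𝒦 P →
      (∀ {Q} → 𝒦 Q → ∃[ m ] (Q ∈ m × ∀ {Y} → Y ∈ m → 𝒦 Y → Y ≃ Q)) →
      (∀ {m} → P ∈ m → ¬ m ≃ r → ∃[ X ] (X ∈ m × ¬ X ∈ r × ¬ 𝒦 X)) →
      ΠProperty ℬ′ ℓ
    Π-property {𝒦} {ℬ′} ℬ′-affine ℬ′⊆𝒦∖P P∈𝒦 tangent-at outside = tangents , no-line-inside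
      where
      tangents : ∀ Q → ℬ′ Q → ∃[ m ] (AffLine m × Q ∈ₗ m × ¬ Parallel ℓ m × AffTangent ℬ′ m)
      tangents Q Q∈ℬ′ with tangent-at (proj₁ (ℬ′⊆𝒦∖P Q∈ℬ′))
      ... | m , Q∈m , unique =
        m , (λ m~r → distinct-lines P∈r P∉m (≃-sym (wrap m~r))) , uninc Q∈m , ∌P⇒¬parallel P∉m ,
        (Q , ℬ′-affine Q Q∈ℬ′ , uninc Q∈m , Q∈ℬ′ , λ Y _ Y∈m Y∈ℬ′ → unwrap (unique (inc Y∈m) (proj₁ (ℬ′⊆𝒦∖P Y∈ℬ′))))
        where
        P∉m : ¬ P ∈ m
        P∉m P∈m = proj₂ (ℬ′⊆𝒦∖P Q∈ℬ′) (unwrap (≃-sym (unique P∈m P∈𝒦)))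

      no-line-inside : ∀ m → AffLine m → Parallel ℓ m → ¬ (∀ X → AffPoint X → X ∈ₗ m → ℬ′ X)
      no-line-inside m m-affine ℓ∥m m⊆ℬ′ with outside (parallel⇒∋P {m} ℓ∥m) (λ m≃r → m-affine (unwrap m≃r))
      ... | X , X∈m , X∉r , X∉𝒦 = X∉𝒦 (proj₁ (ℬ′⊆𝒦∖P (m⊆ℬ′ X (X∉r ∘ inc) (uninc X∈m))))

  ∃Π-property : ∀ {P} {𝒦 ℬ′ : PointSet} → P ∈ r → IsAffSet ℬ′ → (∀ {X} → ℬ′ X → 𝒦 X × ¬ X ~ P) → 𝒦 P →
    (∀ {Q} → 𝒦 Q → ∃[ m ] (Q ∈ m × ∀ {Y} → Y ∈ m → 𝒦 Y → Y ≃ Q)) →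
    (∀ {m} → P ∈ m → ¬ m ≃ r → ∃[ X ] (X ∈ m × ¬ X ∈ r × ¬ 𝒦 X)) →
    ∃[ ℓ ] (AffLine ℓ × ΠProperty ℬ′ ℓ)
  ∃Π-property {P} P∈r ℬ′-affine ℬ′⊆𝒦∖P P∈𝒦 tangent-at outside =
    ℓ , ℓ≄r ∘ wrap , Π-property P∈r P∈ℓ ℓ≄r ℬ′-affine ℬ′⊆𝒦∖P P∈𝒦 tangent-at outside
    where
    ℓ : Line
    ℓ = proj₁ (line-through-other-than P∈r)
    P∈ℓ : P ∈ ℓ
    P∈ℓ = proj₁ (proj₂ (line-through-other-than P∈r))
    ℓ≄r : ¬ ℓ ≃ r
    ℓ≄r = proj₂ (proj₂ (line-through-other-than P∈r))

open import Data.Nat using (_*_; _∸_)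

corollary4p12 : (q : ℕ) (F : FiniteField q) → 5 ≤ q →
    (k : ℕ) → 2 * q ≤ k → k ≤ 3 * q ∸ 5 →
    (r : Plane.Line F) (ℬ′ : Plane.PointSet F) →
    Plane.Affine.MinimalAffBlocking F r ℬ′ →
    Plane.AffBuiltWithKConstruction F k r ℬ′ →
    ∃[ ℓ ] (Plane.Affine.AffLine F r ℓ × Plane.Affine.ΠProperty F r ℬ′ ℓ)
corollary4p12 q F q≥5 _ _ _ r _ ((ℬ′-affine , _) , _)
  (ℬ , P , (_ , K , _ , _ , odd , ℬ⇔𝒦) , (P∈ℬ , P∈ₗr , _) , ℬ′⇔) =
  ∃Π-property {P} {𝒦} P∈r ℬ′-affine (Product.map₁ to𝒦 ∘ Equivalence.to (ℬ′⇔ _)) (to𝒦 P∈ℬ)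
    (tangent transversal) (affine-point-outside-𝒦 (ℕ.<⇒≤ q≥5) P∈r (to𝒦 P∈ℬ))
  where
  open Plane F
  open ProjectivePlane F
  open KConstructionGeometry F K
  open AffineDirection F r
  open FieldProperties F using (2∣q⇒1+1≡0)
  P∈r : P ∈ r
  P∈r = inc P∈ₗr
  to𝒦 : ∀ {X} → ℬ X → 𝒦 X
  to𝒦 = Equivalence.to (ℬ⇔𝒦 _)
  transversal : Transversal
  transversal = Sum.[ odd-transversal ∘ odd , even-transversal ∘ 2∣q⇒1+1≡0 ]′ (m%2≡1⊎2∣m q)
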